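{- Let $G$ and $H$ be finite simple connected graphs, and let $G\vee H$ be any graph obtained by identifying a vertex of $G$ with a vertex of $H$. Then \[ N(P_{G\vee H})=N(P_G)\cdot N(P_H). \]
   Context: For a finite simple graph $G$ on vertex set $[n]=\{1,\dots,n\}$, with $e_i$ the $i$-th standard basis vector of $\mathbb{R}^n$, the symmetric edge polytope is $P_G=\operatorname{conv}\{\pm(e_i-e_j):\{i,j\}\in E(G)\}$. For a polytope $P$, $N(P)$ denotes its number of facets; $N(G)$ also denotes $N(P_G)$. -}

module Defs where

open import Data.Nat using (ℕ; zero; suc)
open import Data.Bool using (Bool; true; false; if_then_else_)
open import Data.Fin using (Fin)
open import Data.Fin.Subset using (Subset; _∈_)
open import Data.Vec using (Vec; []; _∷_; zipWith; foldr; replicate; tabulate; lookup; map)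
open import Data.List as L using (List; length; concat; allFin)
open import Data.List.Relation.Unary.Unique.Propositional using (Unique)
import Data.List.Membership.Propositional as LM
open import Data.Rational using (ℚ; 0ℚ; 1ℚ; _+_; _*_; -_; _-_) renaming (_≤_ to _≤ℚ_)
open import Data.Product using (Σ; ∃; _×_; _,_)
open import Data.Sum using (_⊎_)
open import Relation.Binary.PropositionalEquality using (_≡_)
open import Function.Bundles using (_⇔_)
open import Function.Definitions using (Injective)

record Graph (n : ℕ) : Set where
  field
    adj    : Fin n → Fin n → Bool
    sym    : ∀ i j → adj i j ≡ adj j i
    irrefl : ∀ i → adj i i ≡ false
open Graph public

data Walk {n : ℕ} (G : Graph n) : Fin n → Fin n → Set where
  here : ∀ {i} → Walk G i i
  step : ∀ {i k j} → adj G i k ≡ true → Walk G k j → Walk G i j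

Connected : {n : ℕ} → Graph n → Set
Connected G = ∀ i j → Walk G i j

-- W (on Fin p) is a graph obtained from G (on Fin m) and H (on Fin k)
-- by identifying the vertex u of G with the vertex v of H
-- (up to relabelling of the vertices of W).
record IsWedge {m k p : ℕ} (G : Graph m) (H : Graph k) (W : Graph p) : Set where
  field
    φ      : Fin m → Fin p
    ψ      : Fin k → Fin p
    φ-inj  : Injective _≡_ _≡_ φ
    ψ-inj  : Injective _≡_ _≡_ ψ
    u      : Fin m
    v      : Fin k
    glue   : φ u ≡ ψ v
    only   : ∀ a b → φ a ≡ ψ b → (a ≡ u) × (b ≡ v)
    cover  : ∀ x → (∃ λ a → φ a ≡ x) ⊎ (∃ λ b → ψ b ≡ x)
    adjG   : ∀ a b → adj W (φ a) (φ b) ≡ adj G a b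
    adjH   : ∀ a b → adj W (ψ a) (ψ b) ≡ adj H a b
    noMore : ∀ x y → adj W x y ≡ true →
             (∃ λ a → ∃ λ b → (φ a ≡ x) × (φ b ≡ y)) ⊎
             (∃ λ a → ∃ λ b → (ψ a ≡ x) × (ψ b ≡ y))

dot : {n : ℕ} → Vec ℚ n → Vec ℚ n → ℚ
dot a x = foldr _ _+_ 0ℚ (zipWith _*_ a x)

zeroV : {n : ℕ} → Vec ℚ n
zeroV = replicate _ 0ℚ

_+V_ : {n : ℕ} → Vec ℚ n → Vec ℚ n → Vec ℚ n
_+V_ = zipWith _+_

_·V_ : {n : ℕ} → ℚ → Vec ℚ n → Vec ℚ n
c ·V x = map (c *_) x

sumQ : {s : ℕ} → Vec ℚ s → ℚ
sumQ = foldr _ _+_ 0ℚ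

lincomb : {s n : ℕ} → Vec ℚ s → (Fin s → Vec ℚ n) → Vec ℚ n
lincomb {s} c x = foldr _ _+V_ zeroV (tabulate (λ t → lookup c t ·V x t))

AffIndep : {s n : ℕ} → (Fin s → Vec ℚ n) → Set
AffIndep {s} x = ∀ (c : Vec ℚ s) → sumQ c ≡ 0ℚ → lincomb c x ≡ zeroV →
                 ∀ t → lookup c t ≡ 0ℚ

-- Polytope P = conv(V) for a finite list V of points of ℚ^n.
-- Faces are recorded by the set of indices of generators lying on them.

module _ {n : ℕ} (V : List (Vec ℚ n)) where

  Idx : Set
  Idx = Fin (length V)

  pt : Idx → Vec ℚ n
  pt = L.lookup V

  IsFace : Subset (length V) → Set
  IsFace S = Σ (Vec ℚ n) λ a → Σ ℚ λ b →
             (∀ t → dot a (pt t) ≤ℚ b) × (∀ t → (t ∈ S) ⇔ (dot a (pt t) ≡ b))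

  -- the affine hull of the points indexed by S has exactly d+1 = r
  -- affinely independent points, i.e. conv(S) has dimension r - 1
  AffRank : Subset (length V) → ℕ → Set
  AffRank S r =
    (Σ (Fin r → Idx) λ f → Injective _≡_ _≡_ f × (∀ t → f t ∈ S) × AffIndep (λ t → pt (f t)))
    × (∀ (q : ℕ) (f : Fin q → Idx) → Injective _≡_ _≡_ f → (∀ t → f t ∈ S) →
         AffIndep (λ t → pt (f t)) → q Data.Nat.≤ r)

  full : Subset (length V)
  full = replicate _ true

  IsFacet : Subset (length V) → Set
  IsFacet S = IsFace S × Σ ℕ λ r → AffRank S r × AffRank full (suc r)

  FacetCount : ℕ → Set
  FacetCount N = Σ (List (Subset (length V))) λ Fs →
                   Unique Fs × (length Fs ≡ N) × (∀ S → (S LM.∈ Fs) ⇔ IsFacet S)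

-- Symmetric edge polytope: generators e_i - e_j for all ordered (i,j)
-- with {i,j} ∈ E(G)  (this gives all ±(e_i - e_j)).

e : {n : ℕ} → Fin n → Vec ℚ n
e i = tabulate (λ j → if ⌊ i Data.Fin.≟ j ⌋ then 1ℚ else 0ℚ)
  where open import Relation.Nullary.Decidable using (⌊_⌋)

symEdgeGens : {n : ℕ} → Graph n → List (Vec ℚ n)
symEdgeGens {n} G =
  concat (L.map (λ i → concat (L.map (λ j →
    if adj G i j then L.[ zipWith _-_ (e i) (e j) ] else L.[]) (allFin n))) (allFin n))

NSymEdge : {n : ℕ} → Graph n → ℕ → Set
NSymEdge G N = FacetCount (symEdgeGens G) N

-- conv V of a centrally symmetric V has the origin in its relative interior, so each facet is cut out by a
-- valid inequality a·x ≤ b with b > 0. The generators eᵢ - eⱼ of P_{G∨H} are those of P_G and of P_H,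
-- supported on coordinate blocks that share only the glued vertex. If a·x ≤ b and a′·x ≤ b′ define
-- facets of P_G and P_H, shifting a and a′ to vanish there and rescaling them to the common right-hand
-- side b b′ glues them into a facet of P_{G∨H}; conversely a facet of P_{G∨H} restricts to a facet of
-- each side, and the two constructions are mutually inverse. The dimension counts go through because
-- a linear relation among generators of both sides splits into a relation on each side: every eᵢ - eⱼ
-- has coordinate sum 0, so the coordinate at the glued vertex is determined by the others.

module Submission where

open import Defs hiding (sym)

module SymmetricEdgePolytopes where

  open import Algebra.Bundles using (Ring)
  open import Data.Bool using (Bool; true; if_then_else_)
  open import Data.Bool.Properties using (⇔→≡)
  open import Data.Empty using (⊥; ⊥-elim)
  open import Data.Fin as F using (Fin; zero; suc; _↑ˡ_; _↑ʳ_; splitAt)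
  open import Data.Fin.Properties using (suc-injective; splitAt⁻¹-↑ˡ; splitAt⁻¹-↑ʳ)
  open import Data.Fin.Subset using (Subset; _∈_)
  open import Data.Fin.Subset.Properties using (∈⊤)
  open import Data.List as L using (List; []; _∷_; length; concat; allFin; map; cartesianProductWith)
  import Data.List.Membership.Propositional as List
  open import Data.List.Membership.Propositional.Properties
    using (∈-lookup; ∈-map⁺; ∈-map⁻; ∈-concat⁺′; ∈-concat⁻′; ∈-allFin; ∈-cartesianProductWith⁻; ∈-cartesianProductWith⁺)
  open import Data.List.Properties using (length-map; length-++)
  open import Data.List.Relation.Unary.All as All using (All)
  import Data.List.Relation.Unary.All.Properties as All
  open import Data.List.Relation.Unary.AllPairs using ([]; _∷_)
  open import Data.List.Relation.Unary.Any as Any using (here; there)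
  open import Data.List.Relation.Unary.Any.Properties using (lookup-index)
  open import Data.List.Relation.Unary.Unique.Propositional using (Unique)
  open import Data.List.Relation.Unary.Unique.Propositional.Properties using (++⁺)
  open import Data.Nat as ℕ using (ℕ; zero; suc; s≤s; z≤n)
  import Data.Nat.Properties as ℕP
  open import Data.Product using (Σ; ∃; _×_; _,_; proj₁; proj₂)
  open import Data.Rational as ℚ using (ℚ; 0ℚ; 1ℚ; _+_; _*_; -_; _-_; 1/_; _≤_; _<_)
  open import Data.Rational.Properties hiding (_≟_)
  open import Data.Rational.Solver using (module +-*-Solver)
  open import Data.Sum as Sum using (_⊎_; inj₁; inj₂)
  open import Data.Vec as V using (Vec; lookup; tabulate; zipWith)
  import Data.Vec.Functional as VF
  open import Data.Vec.Functional using (_++_)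
  open import Data.Vec.Functional.Properties using (lookup-++ˡ; lookup-++ʳ)
  open import Data.Vec.Properties
    using (lookup-zipWith; lookup-map; lookup-replicate; lookup∘tabulate; tabulate∘lookup; tabulate-cong; lookup⇒[]=; []=⇒lookup)
  open import Function using (_∘_; _⇔_; mk⇔; Equivalence)
  import Function.Properties.Equivalence as ⇔
  open import Function.Definitions using (Injective)
  open import Relation.Binary.Definitions using (Tri; tri<; tri≈; tri>)
  open import Relation.Binary.PropositionalEquality
  open import Relation.Nullary.Decidable using (Dec; yes; no; ⌊_⌋)
  open import Relation.Nullary.Negation using (¬_)

  open import Algebra.Properties.Semiring.Sum (Ring.semiring +-*-ring)
    using (sum; sum-syntax; sum-cong-≗; sum-replicate-zero; ∑-distrib-+; ∑-comm; *-distribˡ-sum; *-distribʳ-sum)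
  open import Algebra.Properties.Ring +-*-ring using (-1*x≈-x)
  open import Algebra.Properties.Group +-0-group using (x∙y⁻¹≈ε⇒x≈y; ⁻¹-involutive)
  open +-*-Solver using (solve; _:=_; _:+_; _:*_; _:-_; :-_; con)

  private variable
    m n k : ℕ

  sum-zero : {f : Fin n → ℚ} → (∀ i → f i ≡ 0ℚ) → sum f ≡ 0ℚ
  sum-zero {n} f≡0 = trans (sum-cong-≗ f≡0) (sum-replicate-zero n)

  sum-neg : (f : Fin n → ℚ) → ∑[ i < n ] (- f i) ≡ - sum f
  sum-neg f = begin
    ∑[ i < _ ] (- f i)       ≡⟨ sum-cong-≗ (λ i → sym (-1*x≈-x (f i))) ⟩
    ∑[ i < _ ] (-1ℚ * f i)   ≡⟨ *-distribˡ-sum -1ℚ f ⟨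
    -1ℚ * sum f            ≡⟨ -1*x≈-x (sum f) ⟩
    - sum f                ∎
    where open ≡-Reasoning; -1ℚ = - 1ℚ

  sum-↑ : (c : Fin (m ℕ.+ n) → ℚ) → sum c ≡ sum (c ∘ (_↑ˡ n)) + sum (c ∘ (m ↑ʳ_))
  sum-↑ {zero}  c = sym (+-identityˡ (sum c))
  sum-↑ {suc m} c = trans (cong (c zero +_) (sum-↑ {m} (c ∘ suc))) (sym (+-assoc (c zero) _ _))

  sum-single : (f : Fin n → ℚ) (i : Fin n) → (∀ k → k ≢ i → f k ≡ 0ℚ) → sum f ≡ f i
  sum-single f zero    f≡0 = trans (cong (f zero +_) (sum-zero (λ k → f≡0 (suc k) λ ()))) (+-identityʳ (f zero))
  sum-single f (suc i) f≡0 = trans (cong (_+ sum (f ∘ suc)) (f≡0 zero λ ()))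
    (trans (+-identityˡ _) (sum-single (f ∘ suc) i (λ k k≢i → f≡0 (suc k) (k≢i ∘ suc-injective))))

  ↑-elim : (P : Fin (m ℕ.+ n) → Set) → (∀ i → P (i ↑ˡ n)) → (∀ j → P (m ↑ʳ j)) → ∀ k → P k
  ↑-elim {m} P Pˡ Pʳ k with splitAt m k in eq
  ... | inj₁ i = subst P (splitAt⁻¹-↑ˡ eq) (Pˡ i)
  ... | inj₂ j = subst P (splitAt⁻¹-↑ʳ eq) (Pʳ j)

  ++-all : {A : Set} (P : A → Set) (xs : Fin m → A) (ys : Fin n → A) →
           (∀ i → P (xs i)) → (∀ j → P (ys j)) → ∀ k → P ((xs ++ ys) k)
  ++-all P xs ys Pxs Pys = ↑-elim (P ∘ (xs ++ ys))
    (λ i → subst P (sym (lookup-++ˡ xs ys i)) (Pxs i)) (λ j → subst P (sym (lookup-++ʳ xs ys j)) (Pys j))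

  p*q≡0⇒q≡0 : ∀ p q → p ≢ 0ℚ → p * q ≡ 0ℚ → q ≡ 0ℚ
  p*q≡0⇒q≡0 p q p≢0 pq≡0 = begin
    q                  ≡⟨ sym (*-identityˡ q) ⟩
    1ℚ * q             ≡⟨ cong (_* q) (sym (*-inverseˡ p)) ⟩
    ((1/ p) * p) * q   ≡⟨ *-assoc (1/ p) p q ⟩
    (1/ p) * (p * q)   ≡⟨ cong ((1/ p) *_) pq≡0 ⟩
    (1/ p) * 0ℚ        ≡⟨ *-zeroʳ (1/ p) ⟩
    0ℚ                 ∎
    where open ≡-Reasoning
          instance _ = ℚ.≢-nonZero p≢0

  p+p≡0⇒p≡0 : ∀ p → p + p ≡ 0ℚ → p ≡ 0ℚ
  p+p≡0⇒p≡0 p p+p≡0 = p*q≡0⇒q≡0 (1ℚ + 1ℚ) p (λ ())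
    (trans (solve 1 (λ p → (con 1ℚ :+ con 1ℚ) :* p := p :+ p) refl p) p+p≡0)

  p-q≡0⇒p≡q : ∀ p q → p - q ≡ 0ℚ → p ≡ q
  p-q≡0⇒p≡q = x∙y⁻¹≈ε⇒x≈y

  *-cancelˡ-≢0 : ∀ p q r → p ≢ 0ℚ → p * q ≡ p * r → q ≡ r
  *-cancelˡ-≢0 p q r p≢0 pq≡pr = p-q≡0⇒p≡q q r (p*q≡0⇒q≡0 p (q - r) p≢0 (begin
    p * (q - r)        ≡⟨ solve 3 (λ p q r → p :* (q :- r) := p :* q :- p :* r) refl p q r ⟩
    p * q - p * r      ≡⟨ cong (_- p * r) pq≡pr ⟩
    p * r - p * r      ≡⟨ +-inverseʳ (p * r) ⟩
    0ℚ                 ∎))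
    where open ≡-Reasoning

  Points : ℕ → ℕ → Set
  Points k n = Fin k → Vec ℚ n

  LinearRelation : Points k n → (Fin k → ℚ) → Set
  LinearRelation {k} F c = ∀ i → ∑[ t < k ] (c t * lookup (F t) i) ≡ 0ℚ

  LinearlyIndependent : Points k n → Set
  LinearlyIndependent F = ∀ c → LinearRelation F c → ∀ t → c t ≡ 0ℚ

  AffinelyIndependent : Points k n → Set
  AffinelyIndependent F = ∀ c → sum c ≡ 0ℚ → LinearRelation F c → ∀ t → c t ≡ 0ℚ

  sumQ≡sum : (c : Vec ℚ k) → sumQ c ≡ sum (lookup c)
  sumQ≡sum V.[]      = refl
  sumQ≡sum (x V.∷ c) = cong (x +_) (sumQ≡sum c)

  lookup-lincomb : (c : Vec ℚ k) (F : Points k n) (i : Fin n) →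
                   lookup (lincomb c F) i ≡ ∑[ t < k ] (lookup c t * lookup (F t) i)
  lookup-lincomb V.[]       F i = lookup-replicate i 0ℚ
  lookup-lincomb (c₀ V.∷ c) F i =
    trans (lookup-zipWith _+_ i (c₀ ·V F zero) (lincomb c (F ∘ suc)))
          (cong₂ _+_ (lookup-map i (c₀ *_) (F zero)) (lookup-lincomb c (F ∘ suc) i))

  dot≡sum : (a x : Vec ℚ n) → dot a x ≡ ∑[ i < n ] (lookup a i * lookup x i)
  dot≡sum V.[]       V.[]       = refl
  dot≡sum (a V.∷ as) (x V.∷ xs) = cong (a * x +_) (dot≡sum as xs)

  vec-ext : {A : Set} {u w : Vec A n} → (∀ i → lookup u i ≡ lookup w i) → u ≡ w
  vec-ext {u = u} {w} u≗w = trans (sym (tabulate∘lookup u)) (trans (tabulate-cong u≗w) (tabulate∘lookup w))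

  AffIndep⇔AffinelyIndependent : (F : Points k n) → AffIndep F ⇔ AffinelyIndependent F
  AffIndep⇔AffinelyIndependent F = mk⇔ to from
    where
    to : AffIndep F → AffinelyIndependent F
    to ai c Σc≡0 rel t = trans (sym (lookup∘tabulate c t)) (ai (tabulate c) Σ≡0 lincomb≡0 t)
      where
      Σ≡0 = trans (sumQ≡sum (tabulate c)) (trans (sum-cong-≗ (lookup∘tabulate c)) Σc≡0)
      lincomb≡0 = vec-ext λ i → trans (lookup-lincomb (tabulate c) F i)
        (trans (sum-cong-≗ (λ t → cong (_* lookup (F t) i) (lookup∘tabulate c t)))
               (trans (rel i) (sym (lookup-replicate i 0ℚ))))
    from : AffinelyIndependent F → AffIndep F
    from ai c Σc≡0 lincomb≡0 = ai (lookup c) (trans (sym (sumQ≡sum c)) Σc≡0)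
      λ i → trans (sym (lookup-lincomb c F i)) (trans (cong (λ v → lookup v i) lincomb≡0) (lookup-replicate i 0ℚ))

  linearRelation-zero : (F : Points k n) → LinearRelation F (λ _ → 0ℚ)
  linearRelation-zero F i = sum-zero (λ t → *-zeroˡ (lookup (F t) i))

  linearRelation-scale : (F : Points k n) (c : Fin k → ℚ) (κ : ℚ) →
                         LinearRelation F c → LinearRelation F (λ t → κ * c t)
  linearRelation-scale F c κ rel i = begin
    ∑[ t < _ ] ((κ * c t) * lookup (F t) i)   ≡⟨ sum-cong-≗ (λ t → *-assoc κ (c t) (lookup (F t) i)) ⟩
    ∑[ t < _ ] (κ * (c t * lookup (F t) i))   ≡⟨ *-distribˡ-sum κ (λ t → c t * lookup (F t) i) ⟨
    κ * ∑[ t < _ ] (c t * lookup (F t) i)     ≡⟨ cong (κ *_) (rel i) ⟩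
    κ * 0ℚ                                  ≡⟨ *-zeroʳ κ ⟩
    0ℚ                                      ∎
    where open ≡-Reasoning

  linearRelation-dot : (F : Points k n) (c : Fin k → ℚ) (a : Vec ℚ n) →
                       LinearRelation F c → ∑[ t < k ] (c t * dot a (F t)) ≡ 0ℚ
  linearRelation-dot {k} {n} F c a rel = begin
    ∑[ t < k ] (c t * dot a (F t))                        ≡⟨ sum-cong-≗ (λ t → cong (c t *_) (dot≡sum a (F t))) ⟩
    ∑[ t < k ] (c t * ∑[ i < n ] (a′ i * F′ t i))           ≡⟨ sum-cong-≗ (λ t → *-distribˡ-sum (c t) (λ i → a′ i * F′ t i)) ⟩
    ∑[ t < k ] ∑[ i < n ] (c t * (a′ i * F′ t i))          ≡⟨ sum-cong-≗ (λ t → sum-cong-≗ (λ i → swap (c t) (a′ i) (F′ t i))) ⟩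
    ∑[ t < k ] ∑[ i < n ] (a′ i * (c t * F′ t i))          ≡⟨ ∑-comm (λ t i → a′ i * (c t * F′ t i)) ⟩
    ∑[ i < n ] ∑[ t < k ] (a′ i * (c t * F′ t i))          ≡⟨ sum-cong-≗ (λ i → *-distribˡ-sum (a′ i) (λ t → c t * F′ t i)) ⟨
    ∑[ i < n ] (a′ i * ∑[ t < k ] (c t * F′ t i))          ≡⟨ sum-zero (λ i → trans (cong (a′ i *_) (rel i)) (*-zeroʳ (a′ i))) ⟩
    0ℚ                                                    ∎
    where
    open ≡-Reasoning
    a′ = lookup a
    F′ = λ t → lookup (F t)
    swap = solve 3 (λ x y z → x :* (y :* z) := y :* (x :* z)) refl

  -- On a hyperplane a·x = b with b ≠ 0, applying a to a linear relation shows its coefficients sum to 0.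
  onHyperplane⇒linearlyIndependent : (F : Points k n) (a : Vec ℚ n) (b : ℚ) → b ≢ 0ℚ →
    (∀ t → dot a (F t) ≡ b) → AffinelyIndependent F → LinearlyIndependent F
  onHyperplane⇒linearlyIndependent F a b b≢0 on ai c rel = ai c Σc≡0 rel
    where
    Σc≡0 : sum c ≡ 0ℚ
    Σc≡0 = p*q≡0⇒q≡0 b (sum c) b≢0 (begin
      b * sum c                       ≡⟨ *-distribˡ-sum b c ⟩
      ∑[ t < _ ] (b * c t)            ≡⟨ sum-cong-≗ (λ t → trans (*-comm b (c t)) (cong (c t *_) (sym (on t)))) ⟩
      ∑[ t < _ ] (c t * dot a (F t))  ≡⟨ linearRelation-dot F c a rel ⟩
      0ℚ                              ∎)
      where open ≡-Reasoning

  extend-affinelyIndependent : (F : Points k n) (p : Vec ℚ n) (a : Vec ℚ n) (b : ℚ) →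
    (∀ t → dot a (F t) ≡ b) → AffinelyIndependent F → dot a p ≢ b → AffinelyIndependent (p VF.∷ F)
  extend-affinelyIndependent F p a b on ai off c Σc≡0 rel = c≡0
    where
    x  = dot a p
    c₀ = c zero
    Σtail : sum (c ∘ suc) ≡ - c₀
    Σtail = trans (solve 2 (λ u w → w := (u :+ w) :+ (:- u)) refl c₀ (sum (c ∘ suc)))
                  (trans (cong (_+ - c₀) Σc≡0) (+-identityˡ (- c₀)))
    c₀≡0 : c₀ ≡ 0ℚ
    c₀≡0 = p*q≡0⇒q≡0 (x - b) c₀ (off ∘ p-q≡0⇒p≡q x b) (begin
      (x - b) * c₀                               ≡⟨ solve 3 (λ x b c → (x :- b) :* c := c :* x :+ (:- c) :* b) refl x b c₀ ⟩
      c₀ * x + - c₀ * b                          ≡⟨ cong (λ z → c₀ * x + z * b) (sym Σtail) ⟩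
      c₀ * x + sum (c ∘ suc) * b                 ≡⟨ cong (c₀ * x +_) (*-distribʳ-sum b (c ∘ suc)) ⟩
      c₀ * x + ∑[ t < _ ] (c (suc t) * b)       ≡⟨ cong (c₀ * x +_) (sum-cong-≗ (λ t → cong (c (suc t) *_) (sym (on t)))) ⟩
      ∑[ t < _ ] (c t * dot a ((p VF.∷ F) t))      ≡⟨ linearRelation-dot (p VF.∷ F) c a rel ⟩
      0ℚ                                         ∎)
      where open ≡-Reasoning
    relTail : LinearRelation F (c ∘ suc)
    relTail i = begin
      ∑[ t < _ ] (c (suc t) * lookup (F t) i)               ≡⟨ +-identityˡ _ ⟨
      0ℚ + ∑[ t < _ ] (c (suc t) * lookup (F t) i)          ≡⟨ cong (_+ _) (trans (cong (_* lookup p i) c₀≡0) (*-zeroˡ (lookup p i))) ⟨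
      c₀ * lookup p i + ∑[ t < _ ] (c (suc t) * lookup (F t) i) ≡⟨ rel i ⟩
      0ℚ                                                    ∎
      where open ≡-Reasoning
    c≡0 : ∀ t → c t ≡ 0ℚ
    c≡0 zero    = c₀≡0
    c≡0 (suc t) = ai (c ∘ suc) (trans Σtail (cong -_ c₀≡0)) relTail t

  linearlyIndependent⇒affinelyIndependent : (F : Points k n) → LinearlyIndependent F → AffinelyIndependent F
  linearlyIndependent⇒affinelyIndependent F li c _ = li c

  δ : Fin n → Fin n → ℚ
  δ i k = if ⌊ i F.≟ k ⌋ then 1ℚ else 0ℚ

  δ-case : (i k : Fin n) → (i ≡ k × δ i k ≡ 1ℚ) ⊎ (i ≢ k × δ i k ≡ 0ℚ)
  δ-case i k with i F.≟ k
  ... | yes i≡k = inj₁ (i≡k , refl)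
  ... | no  i≢k = inj₂ (i≢k , refl)

  δ-refl : (i : Fin n) → δ i i ≡ 1ℚ
  δ-refl i with δ-case i i
  ... | inj₁ (_ , δ≡1)   = δ≡1
  ... | inj₂ (i≢i , _)   = ⊥-elim (i≢i refl)

  δ-≢ : (i k : Fin n) → i ≢ k → δ i k ≡ 0ℚ
  δ-≢ i k i≢k with δ-case i k
  ... | inj₁ (i≡k , _)   = ⊥-elim (i≢k i≡k)
  ... | inj₂ (_ , δ≡0)   = δ≡0

  sum-*δ : (f : Fin n → ℚ) (i : Fin n) → ∑[ k < n ] (f k * δ i k) ≡ f i
  sum-*δ f i = trans (sum-single _ i (λ k k≢i → trans (cong (f k *_) (δ-≢ i k (k≢i ∘ sym))) (*-zeroʳ (f k))))
                     (trans (cong (f i *_) (δ-refl i)) (*-identityʳ (f i)))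

  sum-δ : (i : Fin n) → sum (δ i) ≡ 1ℚ
  sum-δ i = trans (sum-cong-≗ (λ k → sym (*-identityˡ (δ i k)))) (sum-*δ (λ _ → 1ℚ) i)

  sum-δ-δ : (i j : Fin n) → ∑[ k < n ] (δ i k - δ j k) ≡ 0ℚ
  sum-δ-δ i j = begin
    ∑[ k < _ ] (δ i k - δ j k)   ≡⟨ ∑-distrib-+ (δ i) (λ k → - δ j k) ⟩
    sum (δ i) + ∑[ k < _ ] (- δ j k) ≡⟨ cong₂ _+_ (sum-δ i) (trans (sum-neg (δ j)) (cong -_ (sum-δ j))) ⟩
    1ℚ - 1ℚ                      ≡⟨⟩
    0ℚ                           ∎
    where open ≡-Reasoning

  sum-*-δ-δ : (f : Fin n → ℚ) (i j : Fin n) → ∑[ k < n ] ((δ i k - δ j k) * f k) ≡ f i - f j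
  sum-*-δ-δ f i j = begin
    ∑[ k < _ ] ((δ i k - δ j k) * f k)                      ≡⟨ sum-cong-≗ (λ k → solve 3 (λ x y z → (x :- y) :* z := z :* x :+ (:- (z :* y))) refl (δ i k) (δ j k) (f k)) ⟩
    ∑[ k < _ ] (f k * δ i k + - (f k * δ j k))              ≡⟨ ∑-distrib-+ (λ k → f k * δ i k) (λ k → - (f k * δ j k)) ⟩
    ∑[ k < _ ] (f k * δ i k) + ∑[ k < _ ] (- (f k * δ j k)) ≡⟨ cong₂ _+_ (sum-*δ f i) (trans (sum-neg (λ k → f k * δ j k)) (cong -_ (sum-*δ f j))) ⟩
    f i - f j                                               ∎
    where open ≡-Reasoning

  affinelyIndependent⇒injective : {A : Set} {s : ℕ} (F : A → Vec ℚ n) (f : Fin s → A) →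
    AffinelyIndependent (F ∘ f) → Injective _≡_ _≡_ f
  affinelyIndependent⇒injective F f ai {t} {t′} ft≡ft′ with t F.≟ t′
  ... | yes t≡t′ = t≡t′
  ... | no  t≢t′ = ⊥-elim (1≢0 (trans (sym cₜ) (ai c (sum-δ-δ t t′) rel t)))
    where
    c = λ k → δ t k - δ t′ k
    rel : LinearRelation (F ∘ f) c
    rel i = trans (sum-*-δ-δ (λ k → lookup (F (f k)) i) t t′)
                  (trans (cong (λ x → lookup (F x) i - lookup (F (f t′)) i) ft≡ft′) (+-inverseʳ (lookup (F (f t′)) i)))
    cₜ : c t ≡ 1ℚ
    cₜ = cong₂ _-_ (δ-refl t) (δ-≢ t′ t (t≢t′ ∘ sym))

  edgeVec : Fin n → Fin n → Vec ℚ n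
  edgeVec i j = zipWith _-_ (e i) (e j)

  lookup-edgeVec : (i j k : Fin n) → lookup (edgeVec i j) k ≡ δ i k - δ j k
  lookup-edgeVec i j k = trans (lookup-zipWith _-_ k (e i) (e j)) (cong₂ _-_ (lookup∘tabulate _ k) (lookup∘tabulate _ k))

  lookup-edgeVec-≢ : (i j k : Fin n) → i ≢ k → j ≢ k → lookup (edgeVec i j) k ≡ 0ℚ
  lookup-edgeVec-≢ i j k i≢k j≢k = trans (lookup-edgeVec i j k) (cong₂ _-_ (δ-≢ i k i≢k) (δ-≢ j k j≢k))

  lookup-edgeVec-swap : (i j k : Fin n) → lookup (edgeVec j i) k ≡ - lookup (edgeVec i j) k
  lookup-edgeVec-swap i j k = trans (lookup-edgeVec j i k)
    (trans (solve 2 (λ x y → y :- x := :- (x :- y)) refl (δ i k) (δ j k)) (cong -_ (sym (lookup-edgeVec i j k))))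

  sum-edgeVec : (i j : Fin n) → sum (lookup (edgeVec i j)) ≡ 0ℚ
  sum-edgeVec i j = trans (sum-cong-≗ (lookup-edgeVec i j)) (sum-δ-δ i j)

  dot-edgeVec : (a : Vec ℚ n) (i j : Fin n) → dot a (edgeVec i j) ≡ lookup a i - lookup a j
  dot-edgeVec a i j = trans (dot≡sum a (edgeVec i j))
    (trans (sum-cong-≗ (λ k → trans (cong (lookup a k *_) (lookup-edgeVec i j k)) (*-comm (lookup a k) _)))
           (sum-*-δ-δ (lookup a) i j))

  edgeVec-injective : {i j i′ j′ : Fin n} → i ≢ j → edgeVec i j ≡ edgeVec i′ j′ → i ≡ i′ × j ≡ j′
  edgeVec-injective {i = i} {j} {i′} {j′} i≢j eq = sym (head (at i)) , sym (tail (at j))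
    where
    at : ∀ k → δ i k - δ j k ≡ δ i′ k - δ j′ k
    at k = trans (sym (lookup-edgeVec i j k)) (trans (cong (λ v → lookup v k) eq) (lookup-edgeVec i′ j′ k))
    head : δ i i - δ j i ≡ δ i′ i - δ j′ i → i′ ≡ i
    head with δ-case i i | δ-case j i | δ-case i′ i | δ-case j′ i
    ... | _ | _ | inj₁ (i′≡i , _) | _ = λ _ → i′≡i
    ... | inj₂ (i≢i , _) | _ | _ | _ = ⊥-elim (i≢i refl)
    ... | _ | inj₁ (j≡i , _) | _ | _ = ⊥-elim (i≢j (sym j≡i))
    ... | inj₁ (_ , p) | inj₂ (_ , q) | inj₂ (_ , r) | inj₁ (_ , s) rewrite p | q | r | s = λ ()
    ... | inj₁ (_ , p) | inj₂ (_ , q) | inj₂ (_ , r) | inj₂ (_ , s) rewrite p | q | r | s = λ ()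
    tail : δ i j - δ j j ≡ δ i′ j - δ j′ j → j′ ≡ j
    tail with δ-case i j | δ-case j j | δ-case i′ j | δ-case j′ j
    ... | _ | _ | _ | inj₁ (j′≡j , _) = λ _ → j′≡j
    ... | _ | inj₂ (j≢j , _) | _ | _ = ⊥-elim (j≢j refl)
    ... | inj₁ (i≡j , _) | _ | _ | _ = ⊥-elim (i≢j i≡j)
    ... | inj₂ (_ , p) | inj₁ (_ , q) | inj₁ (_ , r) | inj₂ (_ , s) rewrite p | q | r | s = λ ()
    ... | inj₂ (_ , p) | inj₁ (_ , q) | inj₂ (_ , r) | inj₂ (_ , s) rewrite p | q | r | s = λ ()

  module SymEdgeGens (G : Graph n) where

    Gens : List (Vec ℚ n)
    Gens = symEdgeGens G

    I : Set
    I = Idx Gens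

    P : I → Vec ℚ n
    P = pt Gens

    private
      gensFrom : Fin n → Fin n → List (Vec ℚ n)
      gensFrom i j = if adj G i j then L.[ edgeVec i j ] else L.[]

      ∈-gensFrom : ∀ {x} i j → x List.∈ gensFrom i j → adj G i j ≡ true × x ≡ edgeVec i j
      ∈-gensFrom i j x∈ with adj G i j
      ∈-gensFrom i j (here x≡) | true = refl , x≡

      decode : (t : I) → Σ (Fin n × Fin n) λ (i , j) → adj G i j ≡ true × P t ≡ edgeVec i j
      decode t with ∈-concat⁻′ (L.map (λ i → concat (L.map (gensFrom i) (allFin n))) (allFin n)) (∈-lookup {xs = Gens} t)
      ... | _ , x∈xs , xs∈ with ∈-map⁻ (λ i → concat (L.map (gensFrom i) (allFin n))) xs∈
      ... | i , _ , refl with ∈-concat⁻′ (L.map (gensFrom i) (allFin n)) x∈xs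
      ... | _ , x∈ys , ys∈ with ∈-map⁻ (gensFrom i) ys∈
      ... | j , _ , refl = (i , j) , ∈-gensFrom i j x∈ys

    encode : ∀ i j → adj G i j ≡ true → Σ I λ t → P t ≡ edgeVec i j
    encode i j ij∈E = Any.index mem , sym (lookup-index mem)
      where
      mem₀ : edgeVec i j List.∈ gensFrom i j
      mem₀ rewrite ij∈E = here refl
      mem : edgeVec i j List.∈ Gens
      mem = ∈-concat⁺′ (∈-concat⁺′ mem₀ (∈-map⁺ (gensFrom i) (∈-allFin j)))
                       (∈-map⁺ (λ i → concat (L.map (gensFrom i) (allFin n))) (∈-allFin i))

    src dst : I → Fin n
    src t = proj₁ (proj₁ (decode t))
    dst t = proj₂ (proj₁ (decode t))

    adj-src-dst : ∀ t → adj G (src t) (dst t) ≡ true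
    adj-src-dst t = proj₁ (proj₂ (decode t))

    P≡edgeVec : ∀ t → P t ≡ edgeVec (src t) (dst t)
    P≡edgeVec t = proj₂ (proj₂ (decode t))

    src≢dst : ∀ t → src t ≢ dst t
    src≢dst t s≡d with trans (sym (adj-src-dst t)) (trans (cong (λ z → adj G z (dst t)) s≡d) (irrefl G (dst t)))
    ... | ()

    dot-P : ∀ a t → dot a (P t) ≡ lookup a (src t) - lookup a (dst t)
    dot-P a t = trans (cong (dot a) (P≡edgeVec t)) (dot-edgeVec a (src t) (dst t))

    neg : I → I
    neg t = proj₁ (encode (dst t) (src t) (trans (Graph.sym G (dst t) (src t)) (adj-src-dst t)))

    lookup-P-neg : ∀ t k → lookup (P (neg t)) k ≡ - lookup (P t) k
    lookup-P-neg t k = trans (cong (λ v → lookup v k) (proj₂ (encode (dst t) (src t) _)))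
      (trans (lookup-edgeVec-swap (src t) (dst t) k) (cong (λ v → - lookup v k) (sym (P≡edgeVec t))))

  generator : (G : Graph n) → 2 ℕ.≤ n → Connected G → SymEdgeGens.I G
  generator {suc zero} G (s≤s ()) _
  generator {suc (suc _)} G _ conn with conn zero (suc zero)
  ... | step {k = k} 0k∈E _ = proj₁ (SymEdgeGens.encode G zero k 0k∈E)

  ∈⇔lookup≡true : ∀ {m} (S : Subset m) t → (t ∈ S) ⇔ (lookup S t ≡ true)
  ∈⇔lookup≡true S t = mk⇔ []=⇒lookup (lookup⇒[]= t S)

  module _ {n : ℕ} (V : List (Vec ℚ n)) where

    mkAffRank : ∀ {S r} (f : Fin r → Idx V) → (∀ j → f j ∈ S) → AffinelyIndependent (pt V ∘ f) →
                (∀ {q} (g : Fin q → Idx V) → (∀ j → g j ∈ S) → AffinelyIndependent (pt V ∘ g) → q ℕ.≤ r) →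
                AffRank V S r
    mkAffRank f f∈ f-ai bound =
      (f , affinelyIndependent⇒injective (pt V) f f-ai , f∈ , Equivalence.from (AffIndep⇔AffinelyIndependent (pt V ∘ f)) f-ai) ,
      λ q g _ g∈ g-ai → bound g g∈ (Equivalence.to (AffIndep⇔AffinelyIndependent (pt V ∘ g)) g-ai)

    module Rank {S r} (rank : AffRank V S r) where

      basis : Fin r → Idx V
      basis = proj₁ (proj₁ rank)

      basis-∈ : ∀ j → basis j ∈ S
      basis-∈ = proj₁ (proj₂ (proj₂ (proj₁ rank)))

      basis-independent : AffinelyIndependent (pt V ∘ basis)
      basis-independent = Equivalence.to (AffIndep⇔AffinelyIndependent (pt V ∘ basis)) (proj₂ (proj₂ (proj₂ (proj₁ rank))))

      bound : ∀ {q} (g : Fin q → Idx V) → (∀ j → g j ∈ S) → AffinelyIndependent (pt V ∘ g) → q ℕ.≤ r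
      bound g g∈ g-ai = proj₂ rank _ g (affinelyIndependent⇒injective (pt V) g g-ai) g∈
                          (Equivalence.from (AffIndep⇔AffinelyIndependent (pt V ∘ g)) g-ai)

    module Facet {S} (facet : IsFacet V S) where

      normal : Vec ℚ n
      normal = proj₁ (proj₁ facet)

      rhs : ℚ
      rhs = proj₁ (proj₂ (proj₁ facet))

      valid : ∀ t → dot normal (pt V t) ≤ rhs
      valid = proj₁ (proj₂ (proj₂ (proj₁ facet)))

      onFace : ∀ t → (t ∈ S) ⇔ (dot normal (pt V t) ≡ rhs)
      onFace = proj₂ (proj₂ (proj₂ (proj₁ facet)))

      rank : ℕ
      rank = proj₁ (proj₂ facet)

      rank-face : AffRank V S rank
      rank-face = proj₁ (proj₂ (proj₂ facet))

      rank-full : AffRank V (full V) (suc rank)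
      rank-full = proj₂ (proj₂ (proj₂ facet))

  module CentrallySymmetric {n : ℕ} (V : List (Vec ℚ n)) (neg : Idx V → Idx V)
                            (lookup-neg : ∀ t k → lookup (pt V (neg t)) k ≡ - lookup (pt V t) k) where

    P : Idx V → Vec ℚ n
    P = pt V

    dot-neg : ∀ a t → dot a (P (neg t)) ≡ - dot a (P t)
    dot-neg a t = begin
      dot a (P (neg t))                        ≡⟨ dot≡sum a (P (neg t)) ⟩
      ∑[ k < n ] (lookup a k * lookup (P (neg t)) k) ≡⟨ sum-cong-≗ (λ k → trans (cong (lookup a k *_) (lookup-neg t k)) (sym (neg-distribʳ-* (lookup a k) (lookup (P t) k)))) ⟩
      ∑[ k < n ] (- (lookup a k * lookup (P t) k))   ≡⟨ sum-neg (λ k → lookup a k * lookup (P t) k) ⟩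
      - ∑[ k < n ] (lookup a k * lookup (P t) k)     ≡⟨ cong -_ (dot≡sum a (P t)) ⟨
      - dot a (P t)                            ∎
      where open ≡-Reasoning

    valid⇒-b≤dot : ∀ a b → (∀ t → dot a (P t) ≤ b) → ∀ t → - b ≤ dot a (P t)
    valid⇒-b≤dot a b valid t = subst (- b ≤_) (⁻¹-involutive (dot a (P t)))
      (neg-antimono-≤ (subst (_≤ b) (dot-neg a t) (valid (neg t))))

    -- A face containing all generators has full rank, so a facet misses the origin.
    facet-rhs-positive : ∀ {S} (facet : IsFacet V S) → 0ℚ < Facet.rhs V facet
    facet-rhs-positive {S} facet = by-cmp (<-cmp 0ℚ rhs)
      where
      open Facet V facet
      t₀ = Rank.basis V rank-full zero
      all-on-face : 0ℚ ≡ rhs → ∀ t → t ∈ S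
      all-on-face 0≡b t = Equivalence.from (onFace t) (≤-antisym (valid t)
        (subst (_≤ dot normal (P t)) (subst (λ z → - z ≡ z) 0≡b refl) (valid⇒-b≤dot normal rhs valid t)))
      by-cmp : Tri (0ℚ < rhs) (0ℚ ≡ rhs) (rhs < 0ℚ) → 0ℚ < rhs
      by-cmp (tri< 0<b _ _) = 0<b
      by-cmp (tri≈ _ 0≡b _) = ⊥-elim (ℕP.<-irrefl refl (Rank.bound V rank-face (Rank.basis V rank-full)
                                (all-on-face 0≡b ∘ Rank.basis V rank-full) (Rank.basis-independent V rank-full)))
      by-cmp (tri> _ _ b<0) = ⊥-elim (<-irrefl refl (<-trans (<-≤-trans (neg-antimono-< b<0)
                                (≤-trans (valid⇒-b≤dot normal rhs valid t₀) (valid t₀))) b<0))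

    linearlyIndependent⇒affinelyIndependent-neg : ∀ {q} (g : Fin (suc q) → Idx V) →
      LinearlyIndependent (P ∘ g) → AffinelyIndependent (P ∘ (neg (g zero) VF.∷ g))
    linearlyIndependent⇒affinelyIndependent-neg g li c Σc≡0 rel = c≡0
      where
      c₀ = c zero
      c′ : Fin _ → ℚ
      c′ zero    = c (suc zero) - c₀
      c′ (suc t) = c (suc (suc t))
      rel′ : LinearRelation (P ∘ g) c′
      rel′ i = begin
        (c₁ - c₀) * x₀ + rest                            ≡⟨ solve 4 (λ a d x s → (a :- d) :* x :+ s := d :* (:- x) :+ (a :* x :+ s)) refl c₁ c₀ x₀ rest ⟩
        c₀ * (- x₀) + (c₁ * x₀ + rest)                   ≡⟨ cong (λ z → c₀ * z + (c₁ * x₀ + rest)) (lookup-neg (g zero) i) ⟨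
        c₀ * lookup (P (neg (g zero))) i + (c₁ * x₀ + rest) ≡⟨ rel i ⟩
        0ℚ                                               ∎
        where
        open ≡-Reasoning
        c₁ = c (suc zero)
        x₀ = lookup (P (g zero)) i
        rest = ∑[ t < _ ] (c′ (suc t) * lookup (P (g (suc t))) i)
      c₁≡c₀ : c (suc zero) ≡ c₀
      c₁≡c₀ = p-q≡0⇒p≡q _ _ (li c′ rel′ zero)
      c₀≡0 : c₀ ≡ 0ℚ
      c₀≡0 = p+p≡0⇒p≡0 c₀ (trans (cong (c₀ +_) (sym (trans (cong₂ _+_ c₁≡c₀ (sum-zero (li c′ rel′ ∘ suc))) (+-identityʳ c₀)))) Σc≡0)
      c≡0 : ∀ t → c t ≡ 0ℚ
      c≡0 zero             = c₀≡0
      c≡0 (suc zero)       = trans c₁≡c₀ c₀≡0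
      c≡0 (suc (suc t))    = li c′ rel′ (suc t)

    linearlyIndependent-size : ∀ {q R} → AffRank V (full V) (suc R) → (g : Fin q → Idx V) →
                               LinearlyIndependent (P ∘ g) → q ℕ.≤ R
    linearlyIndependent-size {zero}  _    g li = ℕ.z≤n
    linearlyIndependent-size {suc q} rank g li = ℕP.≤-pred (Rank.bound V rank (neg (g zero) VF.∷ g) (λ _ → ∈⊤)
                                                   (linearlyIndependent⇒affinelyIndependent-neg g li))

    off-hyperplane : ∀ a b → b ≢ 0ℚ → Idx V → Σ (Idx V) λ p → dot a (P p) ≢ b
    off-hyperplane a b b≢0 t with dot a (P t) ℚ.≟ b
    ... | no  ≢b = t , ≢b
    ... | yes ≡b = neg t , λ ≡b′ → b≢0 (p+p≡0⇒p≡0 b (begin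
      b + b                 ≡⟨ cong₂ _+_ (sym ≡b′) (sym ≡b) ⟩
      dot a (P (neg t)) + dot a (P t) ≡⟨ cong (_+ dot a (P t)) (dot-neg a t) ⟩
      - dot a (P t) + dot a (P t)     ≡⟨ +-inverseˡ (dot a (P t)) ⟩
      0ℚ                    ∎))
      where open ≡-Reasoning

    face-respects-points : ∀ {S : Subset (length V)} a b → (∀ t → (t ∈ S) ⇔ (dot a (P t) ≡ b)) →
                           ∀ {t t′} → P t ≡ P t′ → lookup S t ≡ lookup S t′
    face-respects-points {S} a b onFace {t} {t′} Pt≡Pt′ = ⇔→≡
      (⇔.trans (inS t) (⇔.trans (mk⇔ (trans (cong (dot a) (sym Pt≡Pt′))) (trans (cong (dot a) Pt≡Pt′))) (⇔.sym (inS t′))))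
      where
      inS : ∀ t → (lookup S t ≡ true) ⇔ (dot a (P t) ≡ b)
      inS t = ⇔.trans (⇔.sym (∈⇔lookup≡true S t)) (onFace t)

  swapWedge : ∀ {m k p} {G : Graph m} {H : Graph k} {W : Graph p} → IsWedge G H W → IsWedge H G W
  swapWedge w = record
    { φ = ψ ; ψ = φ ; φ-inj = ψ-inj ; ψ-inj = φ-inj ; u = v ; v = u ; glue = sym glue
    ; only = λ a b e → Data.Product.swap (only b a (sym e))
    ; cover = Sum.swap ∘ cover
    ; adjG = adjH ; adjH = adjG
    ; noMore = λ x y e → Sum.swap (noMore x y e) }
    where open IsWedge w

  module Embedding {m k p : ℕ} (G : Graph m) (H : Graph k) (W : Graph p) (w : IsWedge G H W) where
    open IsWedge w
    module GG = SymEdgeGens G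
    module WW = SymEdgeGens W

    τ : GG.I → WW.I
    τ g = proj₁ (WW.encode (φ (GG.src g)) (φ (GG.dst g)) (trans (adjG (GG.src g) (GG.dst g)) (GG.adj-src-dst g)))

    P-τ : ∀ g → WW.P (τ g) ≡ edgeVec (φ (GG.src g)) (φ (GG.dst g))
    P-τ g = proj₂ (WW.encode (φ (GG.src g)) (φ (GG.dst g)) _)

    δ-φ : ∀ i a → δ (φ i) (φ a) ≡ δ i a
    δ-φ i a with δ-case i a | δ-case (φ i) (φ a)
    ... | inj₁ (_ , δ≡1)  | inj₁ (_ , δφ≡1)  = trans δφ≡1 (sym δ≡1)
    ... | inj₂ (_ , δ≡0)  | inj₂ (_ , δφ≡0)  = trans δφ≡0 (sym δ≡0)
    ... | inj₁ (i≡a , _)  | inj₂ (φi≢φa , _) = ⊥-elim (φi≢φa (cong φ i≡a))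
    ... | inj₂ (i≢a , _)  | inj₁ (φi≡φa , _) = ⊥-elim (i≢a (φ-inj φi≡φa))

    lookup-P-τ-φ : ∀ g a → lookup (WW.P (τ g)) (φ a) ≡ lookup (GG.P g) a
    lookup-P-τ-φ g a = begin
      lookup (WW.P (τ g)) (φ a)                                   ≡⟨ cong (λ x → lookup x (φ a)) (P-τ g) ⟩
      lookup (edgeVec (φ (GG.src g)) (φ (GG.dst g))) (φ a)         ≡⟨ lookup-edgeVec (φ (GG.src g)) (φ (GG.dst g)) (φ a) ⟩
      δ (φ (GG.src g)) (φ a) - δ (φ (GG.dst g)) (φ a)             ≡⟨ cong₂ _-_ (δ-φ (GG.src g) a) (δ-φ (GG.dst g) a) ⟩
      δ (GG.src g) a - δ (GG.dst g) a                             ≡⟨ lookup-edgeVec (GG.src g) (GG.dst g) a ⟨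
      lookup (edgeVec (GG.src g) (GG.dst g)) a                    ≡⟨ cong (λ x → lookup x a) (GG.P≡edgeVec g) ⟨
      lookup (GG.P g) a                                           ∎
      where open ≡-Reasoning

    lookup-P-τ-∉φ : ∀ g z → (∀ a → φ a ≢ z) → lookup (WW.P (τ g)) z ≡ 0ℚ
    lookup-P-τ-∉φ g z ∉φ = trans (cong (λ x → lookup x z) (P-τ g)) (lookup-edgeVec-≢ (φ (GG.src g)) (φ (GG.dst g)) z (∉φ (GG.src g)) (∉φ (GG.dst g)))

    lookup-edgeVec-ψ-φ : ∀ x y a → a ≢ u → lookup (edgeVec (ψ x) (ψ y)) (φ a) ≡ 0ℚ
    lookup-edgeVec-ψ-φ x y a a≢u = lookup-edgeVec-≢ (ψ x) (ψ y) (φ a)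
      (λ ψx≡φa → a≢u (proj₁ (only a x (sym ψx≡φa)))) (λ ψy≡φa → a≢u (proj₁ (only a y (sym ψy≡φa))))

    -- The glued coordinate of a relation is forced, since every edge vector has coordinate sum 0.
    relation-restrict : ∀ {s t} (x : Fin s → GG.I) (Y : Fin t → Vec ℚ p) →
      (∀ j a → a ≢ u → lookup (Y j) (φ a) ≡ 0ℚ) → (c : Fin s → ℚ) (d : Fin t → ℚ) →
      (∀ z → ∑[ j < s ] (c j * lookup (WW.P (τ (x j))) z) + ∑[ j < t ] (d j * lookup (Y j) z) ≡ 0ℚ) →
      LinearRelation (GG.P ∘ x) c
    relation-restrict {s} x Y Y-off c d rel = coordinate
      where
      coord : Fin m → ℚ
      coord a = ∑[ j < s ] (c j * lookup (GG.P (x j)) a)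
      off-glue : ∀ a → a ≢ u → coord a ≡ 0ℚ
      off-glue a a≢u = trans (sym (+-identityʳ (coord a)))
        (trans (cong₂ _+_ (sum-cong-≗ (λ j → cong (c j *_) (sym (lookup-P-τ-φ (x j) a))))
                          (sym (sum-zero (λ j → trans (cong (d j *_) (Y-off j a a≢u)) (*-zeroʳ (d j))))))
               (rel (φ a)))
      total : sum coord ≡ 0ℚ
      total = trans (∑-comm (λ a j → c j * lookup (GG.P (x j)) a))
        (sum-zero (λ j → trans (sym (*-distribˡ-sum (c j) (lookup (GG.P (x j)))))
          (trans (cong (λ v → c j * sum (lookup v)) (GG.P≡edgeVec (x j)))
                 (trans (cong (c j *_) (sum-edgeVec (GG.src (x j)) (GG.dst (x j)))) (*-zeroʳ (c j))))))
      coordinate : ∀ a → coord a ≡ 0ℚ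
      coordinate a = by-cases (a F.≟ u)
        where
        by-cases : Dec (a ≡ u) → coord a ≡ 0ℚ
        by-cases (yes a≡u) = trans (cong coord a≡u) (trans (sym (sum-single coord u off-glue)) total)
        by-cases (no  a≢u) = off-glue a a≢u

    relation-extend : ∀ {s} (x : Fin s → GG.I) (c : Fin s → ℚ) → LinearRelation (GG.P ∘ x) c →
                      LinearRelation (WW.P ∘ τ ∘ x) c
    relation-extend {s} x c rel z = by-cover (cover z)
      where
      coord : Fin p → ℚ
      coord z = ∑[ j < s ] (c j * lookup (WW.P (τ (x j))) z)
      at-φ : ∀ a → coord (φ a) ≡ 0ℚ
      at-φ a = trans (sum-cong-≗ (λ j → cong (c j *_) (lookup-P-τ-φ (x j) a))) (rel a)
      at-ψ : ∀ b → Dec (b ≡ v) → coord (ψ b) ≡ 0ℚ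
      at-ψ b (yes b≡v) = subst (λ z → coord z ≡ 0ℚ) (trans glue (cong ψ (sym b≡v))) (at-φ u)
      at-ψ b (no  b≢v) = sum-zero (λ j → trans (cong (c j *_)
        (lookup-P-τ-∉φ (x j) (ψ b) (λ a φa≡ψb → b≢v (proj₂ (only a b φa≡ψb))))) (*-zeroʳ (c j)))
      by-cover : (∃ λ a → φ a ≡ z) ⊎ (∃ λ b → ψ b ≡ z) → coord z ≡ 0ℚ
      by-cover (inj₁ (a , φa≡z)) = subst (λ z → coord z ≡ 0ℚ) φa≡z (at-φ a)
      by-cover (inj₂ (b , ψb≡z)) = subst (λ z → coord z ≡ 0ℚ) ψb≡z (at-ψ b (b F.≟ v))

    pullback : Vec ℚ p → Vec ℚ m
    pullback aW = tabulate (lookup aW ∘ φ)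

    dot-P-τ : ∀ aW g → dot aW (WW.P (τ g)) ≡ lookup aW (φ (GG.src g)) - lookup aW (φ (GG.dst g))
    dot-P-τ aW g = trans (cong (dot aW) (P-τ g)) (dot-edgeVec aW (φ (GG.src g)) (φ (GG.dst g)))

    dot-pullback : ∀ aW g → dot (pullback aW) (GG.P g) ≡ dot aW (WW.P (τ g))
    dot-pullback aW g = trans (GG.dot-P (pullback aW) g)
      (trans (cong₂ _-_ (lookup∘tabulate (lookup aW ∘ φ) (GG.src g)) (lookup∘tabulate (lookup aW ∘ φ) (GG.dst g)))
             (sym (dot-P-τ aW g)))

    φ-generator : ∀ t a b → φ a ≡ WW.src t → φ b ≡ WW.dst t → Σ GG.I λ g → WW.P t ≡ WW.P (τ g)
    φ-generator t a b φa≡ φb≡ = g , (begin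
      WW.P t                                     ≡⟨ WW.P≡edgeVec t ⟩
      edgeVec (WW.src t) (WW.dst t)              ≡⟨ cong₂ edgeVec (sym φa≡) (sym φb≡) ⟩
      edgeVec (φ a) (φ b)                        ≡⟨ cong₂ (λ i j → edgeVec (φ i) (φ j)) (sym (proj₁ ends)) (sym (proj₂ ends)) ⟩
      edgeVec (φ (GG.src g)) (φ (GG.dst g))      ≡⟨ P-τ g ⟨
      WW.P (τ g)                                 ∎)
      where
      open ≡-Reasoning
      ab∈E = trans (sym (adjG a b)) (trans (cong₂ (adj W) φa≡ φb≡) (WW.adj-src-dst t))
      g = proj₁ (GG.encode a b ab∈E)
      ends = edgeVec-injective (GG.src≢dst g) (trans (sym (GG.P≡edgeVec g)) (proj₂ (GG.encode a b ab∈E)))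

  record Split {q : ℕ} (A B : Fin q → Set) : Set where
    field
      s t       : ℕ
      s+t≡q     : s ℕ.+ t ≡ q
      ιˡ        : Fin s → Fin q
      ιʳ        : Fin t → Fin q
      left      : (j : Fin s) → A (ιˡ j)
      right     : (j : Fin t) → B (ιʳ j)
      sum-split : (h : Fin q → ℚ) → sum h ≡ sum (h ∘ ιˡ) + sum (h ∘ ιʳ)
      merge     : (Fin s → ℚ) → (Fin t → ℚ) → Fin q → ℚ
      merge-ιˡ  : ∀ c d j → merge c d (ιˡ j) ≡ c j
      merge-ιʳ  : ∀ c d j → merge c d (ιʳ j) ≡ d j

  infixr 5 _∷ᵈ_
  _∷ᵈ_ : {P : Fin (suc n) → Set} → P zero → (∀ j → P (suc j)) → ∀ j → P j
  (x ∷ᵈ f) zero    = x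
  (x ∷ᵈ f) (suc j) = f j

  module _ {q : ℕ} {A B : Fin (suc q) → Set} where

    consˡ : A zero → Split (A ∘ suc) (B ∘ suc) → Split A B
    consˡ a R = record
      { s = suc s ; t = t ; s+t≡q = cong suc s+t≡q
      ; ιˡ = zero VF.∷ suc ∘ ιˡ ; ιʳ = suc ∘ ιʳ
      ; left = a ∷ᵈ left ; right = right
      ; sum-split = λ h → trans (cong (h zero +_) (sum-split (h ∘ suc))) (sym (+-assoc (h zero) _ _))
      ; merge = λ c d → c zero VF.∷ merge (c ∘ suc) d
      ; merge-ιˡ = λ { c d zero → refl ; c d (suc j) → merge-ιˡ (c ∘ suc) d j }
      ; merge-ιʳ = λ c d j → merge-ιʳ (c ∘ suc) d j }
      where
      open Split R

    consʳ : B zero → Split (A ∘ suc) (B ∘ suc) → Split A B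
    consʳ b R = record
      { s = s ; t = suc t ; s+t≡q = trans (ℕP.+-suc s t) (cong suc s+t≡q)
      ; ιˡ = suc ∘ ιˡ ; ιʳ = zero VF.∷ suc ∘ ιʳ
      ; left = left ; right = b ∷ᵈ right
      ; sum-split = λ h → trans (cong (h zero +_) (sum-split (h ∘ suc)))
          (solve 3 (λ x y z → x :+ (y :+ z) := y :+ (x :+ z)) refl (h zero) (sum (h ∘ suc ∘ ιˡ)) (sum (h ∘ suc ∘ ιʳ)))
      ; merge = λ c d → d zero VF.∷ merge c (d ∘ suc)
      ; merge-ιˡ = λ c d j → merge-ιˡ c (d ∘ suc) j
      ; merge-ιʳ = λ { c d zero → refl ; c d (suc j) → merge-ιʳ c (d ∘ suc) j } }
      where
      open Split R

  split : ∀ {q} {A B : Fin q → Set} → ((k : Fin q) → A k ⊎ B k) → Split A B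
  split {zero} D = record
    { s = 0 ; t = 0 ; s+t≡q = refl ; ιˡ = λ () ; ιʳ = λ () ; left = λ () ; right = λ ()
    ; sum-split = λ _ → refl ; merge = λ _ _ () ; merge-ιˡ = λ _ _ () ; merge-ιʳ = λ _ _ () }
  split {suc q} D with D zero
  ... | inj₁ a = consˡ a (split (D ∘ suc))
  ... | inj₂ b = consʳ b (split (D ∘ suc))

  module _ {A B C : Set} (f : A → B → C) where

    length-cartesianProductWith : (xs : List A) (ys : List B) →
      length (cartesianProductWith f xs ys) ≡ length xs ℕ.* length ys
    length-cartesianProductWith []       ys = refl
    length-cartesianProductWith (x ∷ xs) ys =
      trans (length-++ (map (f x) ys)) (cong₂ ℕ._+_ (length-map (f x) ys) (length-cartesianProductWith xs ys))

    private
      unique-map : (g : B → C) (ys : List B) → (∀ {y y′} → y List.∈ ys → y′ List.∈ ys → g y ≡ g y′ → y ≡ y′) →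
                   Unique ys → Unique (map g ys)
      unique-map g []       _   []          = []
      unique-map g (y ∷ ys) inj (y∉ ∷ uys) =
        All.map⁺ (All.tabulate (λ y′∈ gy≡ → All.lookup y∉ y′∈ (inj (here refl) (there y′∈) gy≡)))
        ∷ unique-map g ys (λ p q → inj (there p) (there q)) uys

    -- Unlike Unique's cartesianProductWith⁺, injectivity is only needed on members of the lists.
    unique-cartesianProductWith : (xs : List A) (ys : List B) →
      (∀ {x x′ y y′} → x List.∈ xs → x′ List.∈ xs → y List.∈ ys → y′ List.∈ ys → f x y ≡ f x′ y′ → x ≡ x′ × y ≡ y′) →
      Unique xs → Unique ys → Unique (cartesianProductWith f xs ys)
    unique-cartesianProductWith []       ys inj []          uys = []
    unique-cartesianProductWith (x ∷ xs) ys inj (x∉ ∷ uxs) uys =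
      ++⁺ (unique-map (f x) ys (λ p q fxy≡ → proj₂ (inj (here refl) (here refl) p q fxy≡)) uys)
          (unique-cartesianProductWith xs ys (λ p q → inj (there p) (there q)) uxs uys)
          disjoint
      where
      disjoint : ∀ {z} → z List.∈ map (f x) ys × z List.∈ cartesianProductWith f xs ys → ⊥
      disjoint (z∈₁ , z∈₂) with ∈-map⁻ (f x) z∈₁ | ∈-cartesianProductWith⁻ f xs ys z∈₂
      ... | y , y∈ , z≡₁ | x′ , y′ , x′∈ , y′∈ , z≡₂ =
        All.lookup x∉ x′∈ (proj₁ (inj (here refl) (there x′∈) y∈ y′∈ (trans (sym z≡₁) z≡₂)))

  module Wedge {m k p : ℕ} (G : Graph m) (H : Graph k) (W : Graph p) (w : IsWedge G H W) where
    open IsWedge w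
    module GG = SymEdgeGens G
    module HH = SymEdgeGens H
    module WW = SymEdgeGens W
    module EG = Embedding G H W w
    module EH = Embedding H G W (swapWedge w)
    module CG = CentrallySymmetric GG.Gens GG.neg GG.lookup-P-neg
    module CH = CentrallySymmetric HH.Gens HH.neg HH.lookup-P-neg
    module CW = CentrallySymmetric WW.Gens WW.neg WW.lookup-P-neg

    τG : GG.I → WW.I
    τG = EG.τ

    τH : HH.I → WW.I
    τH = EH.τ

    FromG FromH : WW.I → Set
    FromG t = Σ GG.I λ g → WW.P t ≡ WW.P (τG g)
    FromH t = Σ HH.I λ h → WW.P t ≡ WW.P (τH h)

    classify : ∀ t → FromG t ⊎ FromH t
    classify t = Sum.map (λ (a , b , φa≡ , φb≡) → EG.φ-generator t a b φa≡ φb≡)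
                         (λ (a , b , ψa≡ , ψb≡) → EH.φ-generator t a b ψa≡ ψb≡)
                         (noMore (WW.src t) (WW.dst t) (WW.adj-src-dst t))

    JointRelation : ∀ {s t} → (Fin s → GG.I) → (Fin t → HH.I) → (Fin s → ℚ) → (Fin t → ℚ) → Set
    JointRelation {s} {t} x y c d = ∀ z →
      ∑[ j < s ] (c j * lookup (WW.P (τG (x j))) z) + ∑[ j < t ] (d j * lookup (WW.P (τH (y j))) z) ≡ 0ℚ

    private variable
      n₁ n₂ : ℕ
      x : Fin n₁ → GG.I
      y : Fin n₂ → HH.I
      c : Fin n₁ → ℚ
      d : Fin n₂ → ℚ

    lookup-P-τH-φ : ∀ h a → a ≢ u → lookup (WW.P (τH h)) (φ a) ≡ 0ℚ
    lookup-P-τH-φ h a a≢u = trans (cong (λ z → lookup z (φ a)) (EH.P-τ h)) (EG.lookup-edgeVec-ψ-φ (HH.src h) (HH.dst h) a a≢u)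

    lookup-P-τG-ψ : ∀ g b → b ≢ v → lookup (WW.P (τG g)) (ψ b) ≡ 0ℚ
    lookup-P-τG-ψ g b b≢v = trans (cong (λ z → lookup z (ψ b)) (EG.P-τ g)) (EH.lookup-edgeVec-ψ-φ (GG.src g) (GG.dst g) b b≢v)

    jointRelation⇒relationᴳ : ∀ x y c d → JointRelation {n₁} {n₂} x y c d → LinearRelation (GG.P ∘ x) c
    jointRelation⇒relationᴳ x y c d = EG.relation-restrict x (WW.P ∘ τH ∘ y) (lookup-P-τH-φ ∘ y) c d

    jointRelation⇒relationᴴ : ∀ x y c d → JointRelation {n₁} {n₂} x y c d → LinearRelation (HH.P ∘ y) d
    jointRelation⇒relationᴴ {n₁} {n₂} x y c d rel = EH.relation-restrict y (WW.P ∘ τG ∘ x) (lookup-P-τG-ψ ∘ x) d c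
      λ z → trans (+-comm (∑[ j < n₂ ] (d j * lookup (WW.P (τH (y j))) z)) (∑[ j < n₁ ] (c j * lookup (WW.P (τG (x j))) z))) (rel z)

    relations⇒jointRelation : LinearRelation (GG.P ∘ x) c → LinearRelation (HH.P ∘ y) d → JointRelation x y c d
    relations⇒jointRelation {x = x} {c = c} {y = y} {d = d} relG relH z =
      trans (cong₂ _+_ (EG.relation-extend x c relG z) (EH.relation-extend y d relH z)) (+-identityʳ 0ℚ)

    relation-++⇒jointRelation : (x : Fin n₁ → GG.I) (y : Fin n₂ → HH.I) (c : Fin (n₁ ℕ.+ n₂) → ℚ) →
      LinearRelation (WW.P ∘ (τG ∘ x ++ τH ∘ y)) c → JointRelation x y (c ∘ (_↑ˡ n₂)) (c ∘ (n₁ ↑ʳ_))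
    relation-++⇒jointRelation {n₁} {n₂} x y c rel z = trans
      (cong₂ _+_ (sum-cong-≗ (λ j → cong (λ i → c (j ↑ˡ n₂) * lookup (WW.P i) z) (sym (lookup-++ˡ (τG ∘ x) (τH ∘ y) j))))
                 (sum-cong-≗ (λ j → cong (λ i → c (n₁ ↑ʳ j) * lookup (WW.P i) z) (sym (lookup-++ʳ (τG ∘ x) (τH ∘ y) j)))))
      (trans (sym (sum-↑ {n₁} {n₂} (λ j → c j * lookup (WW.P ((τG ∘ x ++ τH ∘ y) j)) z))) (rel z))

    ++-affinelyIndependent : AffinelyIndependent (GG.P ∘ x) → LinearlyIndependent (HH.P ∘ y) →
                             AffinelyIndependent (WW.P ∘ (τG ∘ x ++ τH ∘ y))
    ++-affinelyIndependent {n₁} {x} {n₂} {y} aiG liH c Σc≡0 rel = ↑-elim (λ j → c j ≡ 0ℚ) cˡ≡0 cʳ≡0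
      where
      joint = relation-++⇒jointRelation x y c rel
      cʳ≡0 = liH (c ∘ (n₁ ↑ʳ_)) (jointRelation⇒relationᴴ x y (c ∘ (_↑ˡ n₂)) (c ∘ (n₁ ↑ʳ_)) joint)
      Σcˡ≡0 : sum (c ∘ (_↑ˡ n₂)) ≡ 0ℚ
      Σcˡ≡0 = trans (sym (+-identityʳ (sum (c ∘ (_↑ˡ n₂)))))
        (trans (cong (sum (c ∘ (_↑ˡ n₂)) +_) (sym (sum-zero cʳ≡0))) (trans (sym (sum-↑ {n₁} {n₂} c)) Σc≡0))
      cˡ≡0 = aiG (c ∘ (_↑ˡ n₂)) Σcˡ≡0 (jointRelation⇒relationᴳ x y (c ∘ (_↑ˡ n₂)) (c ∘ (n₁ ↑ʳ_)) joint)

    module SplitFamily {q : ℕ} (f : Fin q → WW.I) where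
      open Split (split (classify ∘ f)) public

      xG : Fin s → GG.I
      xG = proj₁ ∘ left

      yH : Fin t → HH.I
      yH = proj₁ ∘ right

      P-ιˡ : ∀ j → WW.P (f (ιˡ j)) ≡ WW.P (τG (xG j))
      P-ιˡ = proj₂ ∘ left

      P-ιʳ : ∀ j → WW.P (f (ιʳ j)) ≡ WW.P (τH (yH j))
      P-ιʳ = proj₂ ∘ right

      merge-relation : ∀ {c d} → LinearRelation (GG.P ∘ xG) c → LinearRelation (HH.P ∘ yH) d →
                       LinearRelation (WW.P ∘ f) (merge c d)
      merge-relation {c} {d} relG relH z = trans (sum-split (λ i → merge c d i * lookup (WW.P (f i)) z))
        (trans (cong₂ _+_ (sum-cong-≗ (λ j → cong₂ (λ a b → a * lookup b z) (merge-ιˡ c d j) (P-ιˡ j)))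
                          (sum-cong-≗ (λ j → cong₂ (λ a b → a * lookup b z) (merge-ιʳ c d j) (P-ιʳ j))))
               (relations⇒jointRelation {x = xG} {c = c} {y = yH} {d = d} relG relH z))

      parts-vanish : AffinelyIndependent (WW.P ∘ f) → ∀ {c d} →
                     LinearRelation (GG.P ∘ xG) c → LinearRelation (HH.P ∘ yH) d → sum c + sum d ≡ 0ℚ →
                     (∀ j → c j ≡ 0ℚ) × (∀ j → d j ≡ 0ℚ)
      parts-vanish ai {c} {d} relG relH Σ≡0 =
        (λ j → trans (sym (merge-ιˡ c d j)) (merged≡0 (ιˡ j))) , (λ j → trans (sym (merge-ιʳ c d j)) (merged≡0 (ιʳ j)))
        where
        merged≡0 = ai (merge c d)
          (trans (sum-split (merge c d)) (trans (cong₂ _+_ (sum-cong-≗ (merge-ιˡ c d)) (sum-cong-≗ (merge-ιʳ c d))) Σ≡0))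
          (merge-relation relG relH)

      affinelyIndependentᴳ : AffinelyIndependent (WW.P ∘ f) → AffinelyIndependent (GG.P ∘ xG)
      affinelyIndependentᴳ ai c Σc≡0 relG = proj₁ (parts-vanish ai relG (linearRelation-zero (HH.P ∘ yH))
        (trans (cong₂ _+_ Σc≡0 (sum-zero {t} (λ _ → refl))) (+-identityʳ 0ℚ)))

      affinelyIndependentᴴ : AffinelyIndependent (WW.P ∘ f) → AffinelyIndependent (HH.P ∘ yH)
      affinelyIndependentᴴ ai d Σd≡0 relH = proj₂ (parts-vanish ai (linearRelation-zero (GG.P ∘ xG)) relH
        (trans (cong₂ _+_ (sum-zero {s} (λ _ → refl)) Σd≡0) (+-identityʳ 0ℚ)))

      -- If a relation c on the G-part has Σ c ≠ 0, then for every relation d on the H-part,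
      -- (Σ d)·c together with (-Σ c)·d is an affine relation of f, which forces d = 0.
      linearlyIndependentᴳ : AffinelyIndependent (WW.P ∘ f) → ¬ LinearlyIndependent (HH.P ∘ yH) →
                             LinearlyIndependent (GG.P ∘ xG)
      linearlyIndependentᴳ ai ¬liH c relG = by-sum (sum c ℚ.≟ 0ℚ)
        where
        by-sum : Dec (sum c ≡ 0ℚ) → ∀ j → c j ≡ 0ℚ
        by-sum (yes Σc≡0) = affinelyIndependentᴳ ai c Σc≡0 relG
        by-sum (no  Σc≢0) = ⊥-elim (¬liH liH)
          where
          liH : LinearlyIndependent (HH.P ∘ yH)
          liH d relH j = p*q≡0⇒q≡0 (- sum c) (d j) (Σc≢0 ∘ neg-injective) (proj₂ vanish j)
            where
            Σ≡0 : ∑[ j < s ] (sum d * c j) + ∑[ j < t ] (- sum c * d j) ≡ 0ℚ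
            Σ≡0 = trans (cong₂ _+_ (sym (*-distribˡ-sum (sum d) c)) (sym (*-distribˡ-sum (- sum c) d)))
                        (solve 2 (λ a b → b :* a :+ (:- a) :* b := con 0ℚ) refl (sum c) (sum d))
            vanish = parts-vanish ai (linearRelation-scale (GG.P ∘ xG) c (sum d) relG)
                                     (linearRelation-scale (HH.P ∘ yH) d (- sum c) relH) Σ≡0

    -- Facets of P_G and P_H give a facet of P_W

    combAt : ∀ {t} → Subset (length GG.Gens) → Subset (length HH.Gens) → FromG t ⊎ FromH t → Bool
    combAt SG SH (inj₁ (g , _)) = lookup SG g
    combAt SG SH (inj₂ (h , _)) = lookup SH h

    comb : Subset (length GG.Gens) → Subset (length HH.Gens) → Subset (length WW.Gens)
    comb SG SH = tabulate (λ t → combAt SG SH (classify t))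

    lookup-comb : ∀ SG SH t → lookup (comb SG SH) t ≡ combAt SG SH (classify t)
    lookup-comb SG SH t = lookup∘tabulate (λ t → combAt SG SH (classify t)) t

    ∈comb⇔ : ∀ SG SH t → (t ∈ comb SG SH) ⇔ (combAt SG SH (classify t) ≡ true)
    ∈comb⇔ SG SH t = ⇔.trans (∈⇔lookup≡true (comb SG SH) t)
      (mk⇔ (trans (sym (lookup-comb SG SH t))) (trans (lookup-comb SG SH t)))

    module CombinedFacet {SG SH} (facetG : IsFacet GG.Gens SG) (facetH : IsFacet HH.Gens SH) where
      open Facet GG.Gens facetG renaming (normal to aG; rhs to bG; valid to validG; onFace to onFaceG;
                                          rank to rG; rank-face to rankFaceG; rank-full to rankFullG)
      open Facet HH.Gens facetH renaming (normal to aH; rhs to bH; valid to validH; onFace to onFaceH;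
                                          rank to rH; rank-face to rankFaceH; rank-full to rankFullH)

      0<bG : 0ℚ < bG
      0<bG = CG.facet-rhs-positive facetG

      0<bH : 0ℚ < bH
      0<bH = CH.facet-rhs-positive facetH

      -- The two functionals are shifted to vanish at the glued vertex and rescaled to a common
      -- right-hand side bG·bH.
      αG : Fin m → ℚ
      αG a = bH * (lookup aG a - lookup aG u)

      αH : Fin k → ℚ
      αH b = bG * (lookup aH b - lookup aH v)

      αG-u : αG u ≡ 0ℚ
      αG-u = trans (cong (bH *_) (+-inverseʳ (lookup aG u))) (*-zeroʳ bH)

      αH-v : αH v ≡ 0ℚ
      αH-v = trans (cong (bG *_) (+-inverseʳ (lookup aH v))) (*-zeroʳ bG)

      glued : (z : Fin p) → (∃ λ a → φ a ≡ z) ⊎ (∃ λ b → ψ b ≡ z) → ℚ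
      glued z (inj₁ (a , _)) = αG a
      glued z (inj₂ (b , _)) = αH b

      aW : Vec ℚ p
      aW = tabulate (λ z → glued z (cover z))

      glued-φ : ∀ a side → glued (φ a) side ≡ αG a
      glued-φ a (inj₁ (a′ , φa′≡φa)) = cong αG (φ-inj φa′≡φa)
      glued-φ a (inj₂ (b , ψb≡φa)) = trans (cong αH (proj₂ ends)) (trans αH-v (trans (sym αG-u) (cong αG (sym (proj₁ ends)))))
        where ends = only a b (sym ψb≡φa)

      glued-ψ : ∀ b side → glued (ψ b) side ≡ αH b
      glued-ψ b (inj₂ (b′ , ψb′≡ψb)) = cong αH (ψ-inj ψb′≡ψb)
      glued-ψ b (inj₁ (a , φa≡ψb)) = trans (cong αG (proj₁ ends)) (trans αG-u (trans (sym αH-v) (cong αH (sym (proj₂ ends)))))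
        where ends = only a b φa≡ψb

      lookup-aW-φ : ∀ a → lookup aW (φ a) ≡ αG a
      lookup-aW-φ a = trans (lookup∘tabulate (λ z → glued z (cover z)) (φ a)) (glued-φ a (cover (φ a)))

      lookup-aW-ψ : ∀ b → lookup aW (ψ b) ≡ αH b
      lookup-aW-ψ b = trans (lookup∘tabulate (λ z → glued z (cover z)) (ψ b)) (glued-ψ b (cover (ψ b)))

      shift : ∀ β x y z → β * (x - z) - β * (y - z) ≡ β * (x - y)
      shift = solve 4 (λ β x y z → β :* (x :- z) :- β :* (y :- z) := β :* (x :- y)) refl

      dot-aW-τG : ∀ g → dot aW (WW.P (τG g)) ≡ bH * dot aG (GG.P g)
      dot-aW-τG g = trans (EG.dot-P-τ aW g) (trans (cong₂ _-_ (lookup-aW-φ (GG.src g)) (lookup-aW-φ (GG.dst g)))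
        (trans (shift bH (lookup aG (GG.src g)) (lookup aG (GG.dst g)) (lookup aG u)) (cong (bH *_) (sym (GG.dot-P aG g)))))

      dot-aW-τH : ∀ h → dot aW (WW.P (τH h)) ≡ bG * dot aH (HH.P h)
      dot-aW-τH h = trans (EH.dot-P-τ aW h) (trans (cong₂ _-_ (lookup-aW-ψ (HH.src h)) (lookup-aW-ψ (HH.dst h)))
        (trans (shift bG (lookup aH (HH.src h)) (lookup aH (HH.dst h)) (lookup aH v)) (cong (bG *_) (sym (HH.dot-P aH h)))))

      bW : ℚ
      bW = bG * bH

      instance
        _ = ℚ.nonNegative (<⇒≤ 0<bG)
        _ = ℚ.nonNegative (<⇒≤ 0<bH)

      validᴳ : ∀ g → dot aW (WW.P (τG g)) ≤ bW
      validᴳ g = subst₂ _≤_ (sym (dot-aW-τG g)) (*-comm bH bG) (*-monoˡ-≤-nonNeg bH (validG g))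

      validᴴ : ∀ h → dot aW (WW.P (τH h)) ≤ bW
      validᴴ h = subst₂ _≤_ (sym (dot-aW-τH h)) refl (*-monoˡ-≤-nonNeg bG (validH h))

      onFaceᴳ : ∀ g → (g ∈ SG) ⇔ (dot aW (WW.P (τG g)) ≡ bW)
      onFaceᴳ g = ⇔.trans (onFaceG g) (mk⇔
        (λ on → trans (dot-aW-τG g) (trans (cong (bH *_) on) (*-comm bH bG)))
        (λ on → *-cancelˡ-≢0 bH (dot aG (GG.P g)) bG (<⇒≢ 0<bH ∘ sym) (trans (sym (dot-aW-τG g)) (trans on (*-comm bG bH)))))

      onFaceᴴ : ∀ h → (h ∈ SH) ⇔ (dot aW (WW.P (τH h)) ≡ bW)
      onFaceᴴ h = ⇔.trans (onFaceH h) (mk⇔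
        (λ on → trans (dot-aW-τH h) (cong (bG *_) on))
        (λ on → *-cancelˡ-≢0 bG (dot aH (HH.P h)) bH (<⇒≢ 0<bG ∘ sym) (trans (sym (dot-aW-τH h)) on)))

      transport : ∀ {t t′} → WW.P t ≡ WW.P t′ → (dot aW (WW.P t) ≡ bW) ⇔ (dot aW (WW.P t′) ≡ bW)
      transport Pt≡ = mk⇔ (trans (cong (dot aW) (sym Pt≡))) (trans (cong (dot aW) Pt≡))

      onFaceAt : ∀ t (side : FromG t ⊎ FromH t) → (combAt SG SH side ≡ true) ⇔ (dot aW (WW.P t) ≡ bW)
      onFaceAt t (inj₁ (g , Pt≡)) = ⇔.trans (⇔.sym (∈⇔lookup≡true SG g)) (⇔.trans (onFaceᴳ g) (⇔.sym (transport Pt≡)))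
      onFaceAt t (inj₂ (h , Pt≡)) = ⇔.trans (⇔.sym (∈⇔lookup≡true SH h)) (⇔.trans (onFaceᴴ h) (⇔.sym (transport Pt≡)))

      onFaceW : ∀ t → (t ∈ comb SG SH) ⇔ (dot aW (WW.P t) ≡ bW)
      onFaceW t = ⇔.trans (∈comb⇔ SG SH t) (onFaceAt t (classify t))

      validAt : ∀ t → FromG t ⊎ FromH t → dot aW (WW.P t) ≤ bW
      validAt t (inj₁ (g , Pt≡)) = subst (_≤ bW) (cong (dot aW) (sym Pt≡)) (validᴳ g)
      validAt t (inj₂ (h , Pt≡)) = subst (_≤ bW) (cong (dot aW) (sym Pt≡)) (validᴴ h)

      ∈comb⇔ᴳ : ∀ {t} g → WW.P t ≡ WW.P (τG g) → (t ∈ comb SG SH) ⇔ (g ∈ SG)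
      ∈comb⇔ᴳ g Pt≡ = ⇔.trans (onFaceW _) (⇔.trans (transport Pt≡) (⇔.sym (onFaceᴳ g)))

      ∈comb⇔ᴴ : ∀ {t} h → WW.P t ≡ WW.P (τH h) → (t ∈ comb SG SH) ⇔ (h ∈ SH)
      ∈comb⇔ᴴ h Pt≡ = ⇔.trans (onFaceW _) (⇔.trans (transport Pt≡) (⇔.sym (onFaceᴴ h)))

      module BG = Rank GG.Gens rankFaceG
      module BH = Rank HH.Gens rankFaceH
      module FG = Rank GG.Gens rankFullG
      module FH = Rank HH.Gens rankFullH

      basisᴴ-linearlyIndependent : LinearlyIndependent (HH.P ∘ BH.basis)
      basisᴴ-linearlyIndependent = onHyperplane⇒linearlyIndependent (HH.P ∘ BH.basis) aH bH (<⇒≢ 0<bH ∘ sym)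
        (λ j → Equivalence.to (onFaceH (BH.basis j)) (BH.basis-∈ j)) BH.basis-independent

      rankFace : AffRank WW.Gens (comb SG SH) (rG ℕ.+ rH)
      rankFace = mkAffRank WW.Gens (τG ∘ BG.basis ++ τH ∘ BH.basis)
        (++-all (_∈ comb SG SH) (τG ∘ BG.basis) (τH ∘ BH.basis)
                (λ j → Equivalence.from (∈comb⇔ᴳ (BG.basis j) refl) (BG.basis-∈ j))
                (λ j → Equivalence.from (∈comb⇔ᴴ (BH.basis j) refl) (BH.basis-∈ j)))
        (++-affinelyIndependent BG.basis-independent basisᴴ-linearlyIndependent)
        bound
        where
        bound : ∀ {q} (f : Fin q → WW.I) → (∀ j → f j ∈ comb SG SH) → AffinelyIndependent (WW.P ∘ f) → q ℕ.≤ rG ℕ.+ rH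
        bound f f∈ ai = subst (ℕ._≤ rG ℕ.+ rH) s+t≡q (ℕP.+-mono-≤
          (BG.bound xG (λ j → Equivalence.to (∈comb⇔ᴳ (xG j) (P-ιˡ j)) (f∈ (ιˡ j))) (affinelyIndependentᴳ ai))
          (BH.bound yH (λ j → Equivalence.to (∈comb⇔ᴴ (yH j) (P-ιʳ j)) (f∈ (ιʳ j))) (affinelyIndependentᴴ ai)))
          where open SplitFamily f

      rankFull : AffRank WW.Gens (full WW.Gens) (suc (rG ℕ.+ rH))
      rankFull = mkAffRank WW.Gens (τG ∘ FG.basis ++ τH ∘ BH.basis) (λ _ → ∈⊤)
        (++-affinelyIndependent {suc rG} {FG.basis} {rH} {BH.basis} FG.basis-independent basisᴴ-linearlyIndependent)
        bound
        where
        bound : ∀ {q} (f : Fin q → WW.I) → (∀ j → f j ∈ full WW.Gens) → AffinelyIndependent (WW.P ∘ f) → q ℕ.≤ suc (rG ℕ.+ rH)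
        bound f _ ai = subst (ℕ._≤ suc (rG ℕ.+ rH)) s+t≡q (sizes (t ℕ.≤? rH))
          where
          open SplitFamily f
          s≤ : s ℕ.≤ suc rG
          s≤ = FG.bound xG (λ _ → ∈⊤) (affinelyIndependentᴳ ai)
          t≤ : t ℕ.≤ suc rH
          t≤ = FH.bound yH (λ _ → ∈⊤) (affinelyIndependentᴴ ai)
          -- One side's part is linearly independent, and is then smaller than that side's full rank.
          sizes : Dec (t ℕ.≤ rH) → s ℕ.+ t ℕ.≤ suc (rG ℕ.+ rH)
          sizes (yes t≤rH) = ℕP.+-mono-≤ s≤ t≤rH
          sizes (no  t≰rH) = subst (s ℕ.+ t ℕ.≤_) (ℕP.+-suc rG rH) (ℕP.+-mono-≤
            (CG.linearlyIndependent-size rankFullG xG (linearlyIndependentᴳ ai (t≰rH ∘ CH.linearlyIndependent-size rankFullH yH)))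
            t≤)

      isFacet : IsFacet WW.Gens (comb SG SH)
      isFacet = (aW , bW , (λ t → validAt t (classify t)) , onFaceW) , rG ℕ.+ rH , rankFace , rankFull

    -- A facet of P_W restricts to facets of P_G and P_H

    restrictᴳ : Subset (length WW.Gens) → Subset (length GG.Gens)
    restrictᴳ S = tabulate (lookup S ∘ τG)

    restrictᴴ : Subset (length WW.Gens) → Subset (length HH.Gens)
    restrictᴴ S = tabulate (lookup S ∘ τH)

    ∈restrictᴳ⇔ : ∀ S g → (g ∈ restrictᴳ S) ⇔ (τG g ∈ S)
    ∈restrictᴳ⇔ S g = ⇔.trans (∈⇔lookup≡true (restrictᴳ S) g)
      (⇔.trans (mk⇔ (trans (sym (lookup∘tabulate (lookup S ∘ τG) g))) (trans (lookup∘tabulate (lookup S ∘ τG) g)))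
               (⇔.sym (∈⇔lookup≡true S (τG g))))

    module RestrictedFacet (g₀ : GG.I) {S} (facetW : IsFacet WW.Gens S) where
      open Facet WW.Gens facetW renaming (normal to aW; rhs to bW; valid to validW; onFace to onFaceW)
      module B = Rank WW.Gens rank-face
      module FW = Rank WW.Gens rank-full
      open SplitFamily B.basis

      bW≢0 : bW ≢ 0ℚ
      bW≢0 = <⇒≢ (CW.facet-rhs-positive facetW) ∘ sym

      aG : Vec ℚ m
      aG = EG.pullback aW

      aH : Vec ℚ k
      aH = EH.pullback aW

      onFaceG : ∀ g → (g ∈ restrictᴳ S) ⇔ (dot aG (GG.P g) ≡ bW)
      onFaceG g = ⇔.trans (∈restrictᴳ⇔ S g)
        (⇔.trans (onFaceW (τG g)) (mk⇔ (trans (EG.dot-pullback aW g)) (trans (sym (EG.dot-pullback aW g)))))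

      validG : ∀ g → dot aG (GG.P g) ≤ bW
      validG g = subst (_≤ bW) (sym (EG.dot-pullback aW g)) (validW (τG g))

      τG∈S : ∀ g → dot aG (GG.P g) ≡ bW → τG g ∈ S
      τG∈S g on = Equivalence.from (onFaceW (τG g)) (trans (sym (EG.dot-pullback aW g)) on)

      τH∈S : ∀ h → dot aH (HH.P h) ≡ bW → τH h ∈ S
      τH∈S h on = Equivalence.from (onFaceW (τH h)) (trans (sym (EH.dot-pullback aW h)) on)

      onX : ∀ j → dot aG (GG.P (xG j)) ≡ bW
      onX j = trans (EG.dot-pullback aW (xG j)) (trans (cong (dot aW) (sym (P-ιˡ j))) (Equivalence.to (onFaceW _) (B.basis-∈ (ιˡ j))))

      onY : ∀ j → dot aH (HH.P (yH j)) ≡ bW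
      onY j = trans (EH.dot-pullback aW (yH j)) (trans (cong (dot aW) (sym (P-ιʳ j))) (Equivalence.to (onFaceW _) (B.basis-∈ (ιʳ j))))

      aiX : AffinelyIndependent (GG.P ∘ xG)
      aiX = affinelyIndependentᴳ B.basis-independent

      liY : LinearlyIndependent (HH.P ∘ yH)
      liY = onHyperplane⇒linearlyIndependent (HH.P ∘ yH) aH bW bW≢0 onY (affinelyIndependentᴴ B.basis-independent)

      rankFaceG : AffRank GG.Gens (restrictᴳ S) s
      rankFaceG = mkAffRank GG.Gens xG (λ j → Equivalence.from (onFaceG (xG j)) (onX j)) aiX bound
        where
        bound : ∀ {q} (g : Fin q → GG.I) → (∀ j → g j ∈ restrictᴳ S) → AffinelyIndependent (GG.P ∘ g) → q ℕ.≤ s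
        bound {q} g g∈ ai = ℕP.+-cancelʳ-≤ t q s (subst (q ℕ.+ t ℕ.≤_) (sym s+t≡q)
          (B.bound (τG ∘ g ++ τH ∘ yH) (++-all (_∈ S) (τG ∘ g) (τH ∘ yH) (λ j → τG∈S (g j) (on j)) (λ j → τH∈S (yH j) (onY j)))
                   (++-affinelyIndependent (linearlyIndependent⇒affinelyIndependent (GG.P ∘ g) li) liY)))
          where
          on : ∀ j → dot aG (GG.P (g j)) ≡ bW
          on j = Equivalence.to (onFaceG (g j)) (g∈ j)
          li = onHyperplane⇒linearlyIndependent (GG.P ∘ g) aG bW bW≢0 on ai

      rankFullG : AffRank GG.Gens (full GG.Gens) (suc s)
      rankFullG = mkAffRank GG.Gens (p₀ VF.∷ xG) (λ _ → ∈⊤)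
        (extend-affinelyIndependent (GG.P ∘ xG) (GG.P p₀) aG bW onX aiX (proj₂ off)) bound
        where
        off = CG.off-hyperplane aG bW bW≢0 g₀
        p₀ = proj₁ off
        bound : ∀ {q} (g : Fin q → GG.I) → (∀ j → g j ∈ full GG.Gens) → AffinelyIndependent (GG.P ∘ g) → q ℕ.≤ suc s
        bound {q} g _ ai = ℕP.+-cancelʳ-≤ t q (suc s) (subst (q ℕ.+ t ℕ.≤_) (cong suc (sym s+t≡q))
          (FW.bound (τG ∘ g ++ τH ∘ yH) (λ _ → ∈⊤) (++-affinelyIndependent ai liY)))

      isFacet : IsFacet GG.Gens (restrictᴳ S)
      isFacet = (aG , bW , validG , onFaceG) , s , rankFaceG , rankFullG

    restrict-recover : ∀ {S} → IsFace WW.Gens S → S ≡ comb (restrictᴳ S) (restrictᴴ S)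
    restrict-recover {S} (a , b , _ , onFace) = vec-ext λ t → sym (trans (lookup-comb (restrictᴳ S) (restrictᴴ S) t) (at t (classify t)))
      where
      at : ∀ t (side : FromG t ⊎ FromH t) → combAt (restrictᴳ S) (restrictᴴ S) side ≡ lookup S t
      at t (inj₁ (g , Pt≡)) = trans (lookup∘tabulate (lookup S ∘ τG) g) (CW.face-respects-points a b onFace (sym Pt≡))
      at t (inj₂ (h , Pt≡)) = trans (lookup∘tabulate (lookup S ∘ τH) h) (CW.face-respects-points a b onFace (sym Pt≡))

    P-τG≢P-τH : ∀ g h → WW.P (τG g) ≢ WW.P (τH h)
    P-τG≢P-τH g h eq = GG.src≢dst g (trans (proj₁ (only _ _ (proj₁ ends))) (sym (proj₁ (only _ _ (proj₂ ends)))))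
      where ends = edgeVec-injective (GG.src≢dst g ∘ φ-inj) (trans (sym (EG.P-τ g)) (trans eq (EH.P-τ h)))

    P-τG-reflect : ∀ g g′ → WW.P (τG g) ≡ WW.P (τG g′) → GG.P g ≡ GG.P g′
    P-τG-reflect g g′ eq = vec-ext λ a →
      trans (sym (EG.lookup-P-τ-φ g a)) (trans (cong (λ z → lookup z (φ a)) eq) (EG.lookup-P-τ-φ g′ a))

    P-τH-reflect : ∀ h h′ → WW.P (τH h) ≡ WW.P (τH h′) → HH.P h ≡ HH.P h′
    P-τH-reflect h h′ eq = vec-ext λ b →
      trans (sym (EH.lookup-P-τ-φ h b)) (trans (cong (λ z → lookup z (ψ b)) eq) (EH.lookup-P-τ-φ h′ b))

    comb-injective : ∀ {SG SG′ SH SH′} → IsFace GG.Gens SG → IsFace GG.Gens SG′ → IsFace HH.Gens SH → IsFace HH.Gens SH′ →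
                     comb SG SH ≡ comb SG′ SH′ → SG ≡ SG′ × SH ≡ SH′
    comb-injective {SG} {SG′} {SH} {SH′} (aG , bG , _ , onG) (aG′ , bG′ , _ , onG′) (aH , bH , _ , onH) (aH′ , bH′ , _ , onH′) eq =
      vec-ext (λ g → atᴳ g (classify (τG g)) (same (τG g))) , vec-ext (λ h → atᴴ h (classify (τH h)) (same (τH h)))
      where
      same : ∀ t → combAt SG SH (classify t) ≡ combAt SG′ SH′ (classify t)
      same t = trans (sym (lookup-comb SG SH t)) (trans (cong (λ S → lookup S t) eq) (lookup-comb SG′ SH′ t))
      atᴳ : ∀ g (side : FromG (τG g) ⊎ FromH (τG g)) → combAt SG SH side ≡ combAt SG′ SH′ side → lookup SG g ≡ lookup SG′ g
      atᴳ g (inj₁ (g′ , eqP)) same′ = trans (CG.face-respects-points aG bG onG (P-τG-reflect g g′ eqP))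
                                         (trans same′ (sym (CG.face-respects-points aG′ bG′ onG′ (P-τG-reflect g g′ eqP))))
      atᴳ g (inj₂ (h , eqP)) _ = ⊥-elim (P-τG≢P-τH g h eqP)
      atᴴ : ∀ h (side : FromG (τH h) ⊎ FromH (τH h)) → combAt SG SH side ≡ combAt SG′ SH′ side → lookup SH h ≡ lookup SH′ h
      atᴴ h (inj₂ (h′ , eqP)) same′ = trans (CH.face-respects-points aH bH onH (P-τH-reflect h h′ eqP))
                                         (trans same′ (sym (CH.face-respects-points aH′ bH′ onH′ (P-τH-reflect h h′ eqP))))
      atᴴ h (inj₁ (g , eqP)) _ = ⊥-elim (P-τG≢P-τH g h (sym eqP))

  module _ {m k p : ℕ} {G : Graph m} {H : Graph k} {W : Graph p} (w : IsWedge G H W) where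
    private
      module WG = Wedge G H W w
      module WH = Wedge H G W (swapWedge w)
      open WG using (module GG; module HH; module WW; comb; restrictᴳ; restrictᴴ)

    wedge-facetCount : GG.I → HH.I → ∀ a b → FacetCount GG.Gens a → FacetCount HH.Gens b → FacetCount WW.Gens (a ℕ.* b)
    wedge-facetCount g₀ h₀ a b (FsG , uniqueG , lengthG , ∈FsG⇔) (FsH , uniqueH , lengthH , ∈FsH⇔) =
      FsW , unique-cartesianProductWith comb FsG FsH comb-injective uniqueG uniqueH
          , trans (length-cartesianProductWith comb FsG FsH) (cong₂ ℕ._*_ lengthG lengthH)
          , λ S → mk⇔ (to S) (from S)
      where
      FsW = cartesianProductWith comb FsG FsH
      faceG : ∀ {S} → S List.∈ FsG → IsFace GG.Gens S
      faceG {S} S∈ = proj₁ (Equivalence.to (∈FsG⇔ S) S∈)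
      faceH : ∀ {S} → S List.∈ FsH → IsFace HH.Gens S
      faceH {S} S∈ = proj₁ (Equivalence.to (∈FsH⇔ S) S∈)
      comb-injective : ∀ {SG SG′ SH SH′} → SG List.∈ FsG → SG′ List.∈ FsG → SH List.∈ FsH → SH′ List.∈ FsH →
                       comb SG SH ≡ comb SG′ SH′ → SG ≡ SG′ × SH ≡ SH′
      comb-injective SG∈ SG′∈ SH∈ SH′∈ = WG.comb-injective (faceG SG∈) (faceG SG′∈) (faceH SH∈) (faceH SH′∈)
      to : ∀ S → S List.∈ FsW → IsFacet WW.Gens S
      to S S∈ = let SG , SH , SG∈ , SH∈ , S≡ = ∈-cartesianProductWith⁻ comb FsG FsH S∈ in
        subst (IsFacet WW.Gens) (sym S≡) (WG.CombinedFacet.isFacet (Equivalence.to (∈FsG⇔ SG) SG∈) (Equivalence.to (∈FsH⇔ SH) SH∈))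
      -- WH.restrictᴳ is definitionally WG.restrictᴴ, so the H-side reuses the G-side argument.
      from : ∀ S → IsFacet WW.Gens S → S List.∈ FsW
      from S facet = subst (List._∈ FsW) (sym (WG.restrict-recover (proj₁ facet)))
        (∈-cartesianProductWith⁺ comb (Equivalence.from (∈FsG⇔ (restrictᴳ S)) (WG.RestrictedFacet.isFacet g₀ facet))
                                      (Equivalence.from (∈FsH⇔ (restrictᴴ S)) (WH.RestrictedFacet.isFacet h₀ facet)))

open import Data.Nat using (ℕ; _*_; _≤_)
open SymmetricEdgePolytopes using (generator; wedge-facetCount)

proposition2p7 : ∀ {m k p : ℕ} (G : Graph m) (H : Graph k) (W : Graph p) →
    2 ≤ m → 2 ≤ k → Connected G → Connected H → IsWedge G H W →
    ∀ (a b : ℕ) → NSymEdge G a → NSymEdge H b → NSymEdge W (a * b)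
proposition2p7 G H W 2≤m 2≤k conn-G conn-H w =
  wedge-facetCount w (generator G 2≤m conn-G) (generator H 2≤k conn-H)
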